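{- Let $w\in S_\infty$. Then \[ \mathfrak{G}^{(\beta)}_w(x;y)=R_1\big(\mathfrak{G}^{(\beta)}_w(x;y)\big)+\sum_{(u,k):\ w=u*s_k}\beta^{\delta_{w,u}}\,x_k\cdot R_k\big(\mathfrak{G}^{(\beta)}_u(x;y)\big), \] where $k$ ranges over $\mathbb{N}$ and $\delta_{w,u}=1$ if $w=u$, $0$ otherwise.
   Context: $S_\infty$ = permutations of $\mathbb{N}=\{1,2,\dots\}$ with finite support, $s_i=(i\ i+1)$, $\ell$ = length. Demazure product $*$: associative product with $w*s_i=ws_i$ if $\ell(ws_i)>\ell(w)$ and $w*s_i=w$ otherwise. Positions $(i,j)$: $i$ = row (downward), $j$ = column (rightward). An ordinary pipe dream is a finite subset $P\subseteq\mathbb{N}\times\mathbb{N}$; its permutation is $\partial(P)=s_{a_1}*\cdots*s_{a_r}$ where $(a_1,\dots,a_r)$ lists the values $i+j-1$ for $(i,j)\in P$, reading each row right to left and rows top to bottom. An ordinary super pipe dream is a pair $(P_x,P_y)$ of ordinary pipe dreams (not necessarily disjoint); its permutation is $\partial(P_x\cup P_y)$ and its weight is $\beta^{|P_x|+|P_y|-\ell(\partial(P_x\cup P_y))}\prod_{(i,j)\in P_x}x_i\prod_{(i,j)\in P_y}y_j$. The double Grothendieck polynomial $\mathfrak{G}^{(\beta)}_w(x;y)\in\mathbb{Z}[\beta][x_i,y_j]$ is the sum of the weights of all ordinary super pipe dreams with permutation $w$ (note: with this convention it corresponds to substituting $-y$ in the more common convention). For $k\in\mathbb{N}$, $R_k$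 is the ring endomorphism of $\mathbb{Z}[\beta][x;y]$ with $x_i\mapsto x_i$ for $i<k$, $x_k\mapsto0$, $x_{i+1}\mapsto x_i$ for $i\ge k$, fixing $\beta$ and all $y_j$. -}

module Defs where

open import Level using (Level)
open import Data.Bool using (Bool; true; false; if_then_else_; _∨_)
open import Data.Nat using (ℕ; zero; suc; _∸_; _+_; _<?_; _≟_)
open import Data.Product using (_×_; _,_; proj₁; proj₂)
open import Data.List using (List; []; _∷_; map; concatMap; upTo; downFrom; length; filter; foldl; foldr; zip; zipWith; _++_; cartesianProduct)
open import Data.List.Properties using (≡-dec)
open import Relation.Nullary using (does)
open import Algebra.Bundles using (CommutativeRing)

-- Permutations in one-line notation.
-- An element of S_n ⊆ S_∞ (permutations of {1,2,...} fixing every i > n)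
-- is represented by its one-line notation [w(1), ..., w(n)] (a list of length n).

insertAll : ℕ → List ℕ → List (List ℕ)
insertAll a []       = (a ∷ []) ∷ []
insertAll a (b ∷ bs) = (a ∷ b ∷ bs) ∷ map (b ∷_) (insertAll a bs)

Sym : ℕ → List (List ℕ)
Sym zero    = [] ∷ []
Sym (suc n) = concatMap (insertAll (suc n)) (Sym n)

idPerm : ℕ → List ℕ
idPerm n = map suc (upTo n)

-- right multiplication by s_i = (i i+1) (1-based): swaps positions i and i+1
-- of the one-line notation (identity if i = 0 or i ≥ n)
mulS : List ℕ → ℕ → List ℕ
mulS (a ∷ b ∷ r) (suc zero)    = b ∷ a ∷ r
mulS (a ∷ r)     (suc (suc i)) = a ∷ mulS r (suc i)
mulS l           _             = l

len : List ℕ → ℕ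
len []      = 0
len (a ∷ r) = length (filter (λ b → b <? a) r) + len r

dem : List ℕ → ℕ → List ℕ
dem w i = if does (len w <? len (mulS w i)) then mulS w i else w

_==_ : List ℕ → List ℕ → Bool
u == v = does (≡-dec _≟_ u v)

-- Pipe dreams.
-- Staircase of size n: the cells (i,j) with i,j ≥ 1 and i+j-1 ≤ n-1, listed in
-- reading order: rows top to bottom, each row right to left.
cells : ℕ → List (ℕ × ℕ)
cells n = concatMap (λ i → map (λ j → (i , j)) (map suc (downFrom (n ∸ i)))) (map suc (upTo n))

-- all Boolean masks of length m (= all subsets of the staircase)
masks : ℕ → List (List Bool)
masks zero    = [] ∷ []
masks (suc m) = map (true ∷_) (masks m) ++ map (false ∷_) (masks m)

card : List Bool → ℕ
card []           = 0
card (true ∷ bs)  = suc (card bs)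
card (false ∷ bs) = card bs

-- ∂(P) for the pipe dream P ⊆ staircase(n) given by a mask:
-- s_{a_1} * ... * s_{a_r}, a = i+j-1, cells in reading order, computed in S_n
∂ : ℕ → List Bool → List ℕ
∂ n mask = foldl step (idPerm n) (zip (cells n) mask)
  where
  step : List ℕ → (ℕ × ℕ) × Bool → List ℕ
  step w ((i , j) , true)  = dem w ((i + j) ∸ 1)
  step w ((i , j) , false) = w

-- Polynomials in Z[β][x_i, y_j] are represented by their evaluation maps
-- into an arbitrary commutative ring R (β ∈ R, x, y : ℕ → R; index 0 unused).

module Poly {c ℓ : Level} (R : CommutativeRing c ℓ) where
  open CommutativeRing R using (Carrier; 0#; 1#) renaming (_+_ to _⊕_; _*_ to _⊗_)

  Fn : Set c
  Fn = Carrier → (ℕ → Carrier) → (ℕ → Carrier) → Carrier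

  sumL : {A : Set} → List A → (A → Carrier) → Carrier
  sumL l f = foldr (λ a s → f a ⊕ s) 0# l

  pow : Carrier → ℕ → Carrier
  pow b zero    = 1#
  pow b (suc m) = b ⊗ pow b m

  prodCells : List ((ℕ × ℕ) × Bool) → ((ℕ × ℕ) → Carrier) → Carrier
  prodCells []                  f = 1#
  prodCells ((p , true)  ∷ ps)  f = f p ⊗ prodCells ps f
  prodCells ((p , false) ∷ ps)  f = prodCells ps f

  weight : ℕ → List Bool → List Bool → Fn
  weight n px py β x y =
    pow β ((card px + card py) ∸ len (∂ n (zipWith _∨_ px py)))
    ⊗ (prodCells (zip (cells n) px) (λ p → x (proj₁ p))
    ⊗ prodCells (zip (cells n) py) (λ p → y (proj₂ p)))

  -- double Grothendieck polynomial of w ∈ S_n, as a sum over super pipe dreams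
  -- inside the staircase of size n (the others have permutation ∉ S_n)
  G : ℕ → List ℕ → Fn
  G n w β x y =
    sumL (masks (length (cells n))) λ px →
    sumL (masks (length (cells n))) λ py →
      if ∂ n (zipWith _∨_ px py) == w then weight n px py β x y else 0#

  shift : ℕ → (ℕ → Carrier) → (ℕ → Carrier)
  shift k x i = if does (i <? k) then x i else (if does (i ≟ k) then 0# else x (i ∸ 1))

  Rop : ℕ → Fn → Fn
  Rop k F β x y = F β (shift k x) y

{-# OPTIONS --safe #-}
module Submission where

-- Summing over the four choices at each cell (empty, x, y or both) writes G_w(x;y) as a transfer
-- matrix: T(x) δ_w evaluated at the identity, where T(x) is the product over the staircase, in
-- reading order, of h_{i+j-1}(x_i ⊕ y_j) = 1 + (x_i ⊕ y_j) π_{i+j-1}, with p ⊕ q = p + q + βpq and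
-- π_a F (v) = β^{1 + ℓ(v) - ℓ(v * s_a)} F (v * s_a).  A composite of π's is a power of β times
-- evaluation at a Demazure product, and that power only depends on the number of letters and on the
-- endpoint; so the π's inherit the idempotence, commutation and braid relations of the Demazure
-- product, which acts on adjacent entries as a compare-exchange.  Hence h_a(p) h_a(q) = h_a(p ⊕ q),
-- far h's commute, and the h's satisfy the Yang-Baxter equation.  A train argument then shows that
-- moving x_k from row k to row k+1 costs a factor h_k(x_k) on the right: T(R_{k+1} x) = T(R_k x) h_k(x_k).
-- Telescoping from R_n x, which agrees with x on the staircase, down to R_1 x gives
-- G_w = R_1 G_w + Σ_k x_k T(R_k x) π_k δ_w, and expanding π_k δ_w in the indicators δ_u yields the
-- coefficients β^{δ_{w,u}} x_k [u * s_k = w].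

open import Defs
open import Level using (Level)
open import Data.Nat using (ℕ; suc; _∸_)
open import Data.Bool using (if_then_else_)
open import Data.Product using (_×_; _,_; proj₁; proj₂)
open import Data.List using (List; map; upTo; cartesianProduct)
open import Data.List.Membership.Propositional using (_∈_)
open import Algebra.Bundles using (CommutativeRing)

module Permutations where

  open import Data.Nat using (zero; _+_; _≤_; _<_; _<?_; _⊔_; _⊓_; s≤s; z≤n; z<s)
  open import Data.Nat.Properties
  open import Data.Bool using (true; false; _∨_)
  open import Data.List using ([]; _∷_; _++_; [_]; length; filter; foldl; applyUpTo; zipWith)
  open import Data.List.Properties using (filter-accept; filter-reject; filter-none; map-upTo)
  import Data.List.Relation.Unary.All as All
  open import Data.List.Relation.Unary.Any using (here; there)
  open import Data.List.Relation.Binary.Permutation.Propositional using (_↭_; ↭-refl; prep; swap)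
  open import Data.List.Relation.Binary.Permutation.Propositional.Properties using (↭-length; filter-↭)
  open import Data.Sum using (_⊎_; inj₁; inj₂)
  open import Function using (_∘_)
  open import Relation.Binary.PropositionalEquality hiding ([_])
  open import Relation.Binary.Definitions using (tri<; tri≈; tri>)
  open import Relation.Nullary using (yes; no; ¬_)
  open import Relation.Nullary.Decidable using (dec-true; dec-false)
  open import Algebra.Properties.CommutativeSemigroup +-commutativeSemigroup using (x∙yz≈y∙xz)

  -- Inversions and the Demazure product

  below : ℕ → List ℕ → ℕ
  below p r = length (filter (_<? p) r)

  mulS-cons : ∀ p r a → mulS (p ∷ r) (suc (suc a)) ≡ p ∷ mulS r (suc a)
  mulS-cons p []      a = refl
  mulS-cons p (q ∷ r) a = refl

  mulS-↭ : ∀ v a → mulS v a ↭ v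
  mulS-↭ []          _             = ↭-refl
  mulS-↭ (p ∷ [])    zero          = ↭-refl
  mulS-↭ (p ∷ [])    (suc zero)    = ↭-refl
  mulS-↭ (p ∷ q ∷ r) zero          = ↭-refl
  mulS-↭ (p ∷ q ∷ r) (suc zero)    = swap q p ↭-refl
  mulS-↭ (p ∷ r)     (suc (suc a)) rewrite mulS-cons p r a = prep p (mulS-↭ r (suc a))

  below-mulS : ∀ p r a → below p (mulS r a) ≡ below p r
  below-mulS p r a = ↭-length (filter-↭ (_<? p) (mulS-↭ r a))

  len-mulS-cons : ∀ p r a → len (mulS (p ∷ r) (suc (suc a))) ≡ below p r + len (mulS r (suc a))
  len-mulS-cons p r a = begin
    len (mulS (p ∷ r) (suc (suc a)))                ≡⟨ cong len (mulS-cons p r a) ⟩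
    below p (mulS r (suc a)) + len (mulS r (suc a)) ≡⟨ cong (_+ _) (below-mulS p r (suc a)) ⟩
    below p r + len (mulS r (suc a))                ∎
    where open ≡-Reasoning

  len-swap : ∀ {p q} r → p < q → len (q ∷ p ∷ r) ≡ suc (len (p ∷ q ∷ r))
  len-swap {p} {q} r p<q = begin
    below q (p ∷ r) + (below p r + len r)     ≡⟨ cong (λ m → length m + _) (filter-accept (_<? q) p<q) ⟩
    suc (below q r + (below p r + len r))     ≡⟨ cong suc (x∙yz≈y∙xz (below q r) (below p r) (len r)) ⟩
    suc (below p r + (below q r + len r))     ≡⟨ cong (λ m → suc (length m + _)) (filter-reject (_<? p) (<⇒≯ p<q)) ⟨
    suc (below p (q ∷ r) + (below q r + len r)) ∎
    where open ≡-Reasoning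

  len-mulS-≤ : ∀ v a → len (mulS v a) ≤ suc (len v)
  len-mulS-≤ []          _             = n≤1+n 0
  len-mulS-≤ (p ∷ [])    zero          = n≤1+n _
  len-mulS-≤ (p ∷ [])    (suc zero)    = n≤1+n _
  len-mulS-≤ (p ∷ q ∷ r) zero          = n≤1+n _
  len-mulS-≤ (p ∷ q ∷ r) (suc zero)    with <-cmp p q
  ... | tri< p<q _ _ = ≤-reflexive (len-swap r p<q)
  ... | tri≈ _ refl _ = n≤1+n _
  ... | tri> _ _ q<p = m≤n⇒m≤1+n (≤-trans (n≤1+n _) (≤-reflexive (sym (len-swap r q<p))))
  len-mulS-≤ (p ∷ r)     (suc (suc a)) = begin
    len (mulS (p ∷ r) (suc (suc a)))               ≡⟨ len-mulS-cons p r a ⟩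
    below p r + len (mulS r (suc a))               ≤⟨ +-monoʳ-≤ (below p r) (len-mulS-≤ r (suc a)) ⟩
    below p r + suc (len r)                        ≡⟨ +-suc (below p r) (len r) ⟩
    suc (len (p ∷ r))                              ∎
    where open ≤-Reasoning

  dem-ascent : ∀ v a → len v < len (mulS v a) → dem v a ≡ mulS v a
  dem-ascent v a lt = cong (λ b → if b then mulS v a else v) (dec-true (len v <? len (mulS v a)) lt)

  dem-stay : ∀ v a → ¬ len v < len (mulS v a) → dem v a ≡ v
  dem-stay v a ¬lt = cong (λ b → if b then mulS v a else v) (dec-false (len v <? len (mulS v a)) ¬lt)

  dem-cases : ∀ v a → dem v a ≡ v ⊎ len (dem v a) ≡ suc (len v)
  dem-cases v a with len v <? len (mulS v a)
  ... | yes lt = inj₂ (trans (cong len (dem-ascent v a lt)) (≤-antisym (len-mulS-≤ v a) lt))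
  ... | no ¬lt = inj₁ (dem-stay v a ¬lt)

  len-dem-≤ : ∀ v a → len (dem v a) ≤ suc (len v)
  len-dem-≤ v a with dem-cases v a
  ... | inj₁ stay rewrite stay = n≤1+n (len v)
  ... | inj₂ up                = ≤-reflexive up

  dem-↭ : ∀ v a → dem v a ↭ v
  dem-↭ v a with len v <? len (mulS v a)
  ... | yes lt = subst (_↭ v) (sym (dem-ascent v a lt)) (mulS-↭ v a)
  ... | no ¬lt = subst (_↭ v) (sym (dem-stay v a ¬lt)) ↭-refl

  dem-cons : ∀ p r a → dem (p ∷ r) (suc (suc a)) ≡ p ∷ dem r (suc a)
  dem-cons p r a with len r <? len (mulS r (suc a))
  ... | yes lt = begin
    dem (p ∷ r) (suc (suc a)) ≡⟨ dem-ascent (p ∷ r) (suc (suc a)) lt′ ⟩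
    mulS (p ∷ r) (suc (suc a)) ≡⟨ mulS-cons p r a ⟩
    p ∷ mulS r (suc a)         ≡⟨ cong (p ∷_) (dem-ascent r (suc a) lt) ⟨
    p ∷ dem r (suc a)          ∎
    where
    open ≡-Reasoning
    lt′ : len (p ∷ r) < len (mulS (p ∷ r) (suc (suc a)))
    lt′ = subst (len (p ∷ r) <_) (sym (len-mulS-cons p r a)) (+-monoʳ-< (below p r) lt)
  ... | no ¬lt = trans (dem-stay (p ∷ r) (suc (suc a)) ¬lt′) (cong (p ∷_) (sym (dem-stay r (suc a) ¬lt)))
    where
    ¬lt′ : ¬ len (p ∷ r) < len (mulS (p ∷ r) (suc (suc a)))
    ¬lt′ lt = ¬lt (+-cancelˡ-< (below p r) _ _ (subst (len (p ∷ r) <_) (len-mulS-cons p r a) lt))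

  compareExchange : List ℕ → ℕ → List ℕ
  compareExchange (p ∷ r)     (suc (suc a)) = p ∷ compareExchange r (suc a)
  compareExchange (p ∷ q ∷ r) (suc zero)    = p ⊔ q ∷ p ⊓ q ∷ r
  compareExchange v           _             = v

  dem≡compareExchange : ∀ v a → dem v a ≡ compareExchange v a
  dem≡compareExchange []          a             = refl
  dem≡compareExchange (p ∷ [])    zero          = refl
  dem≡compareExchange (p ∷ [])    (suc zero)    = refl
  dem≡compareExchange (p ∷ q ∷ r) zero          = dem-stay (p ∷ q ∷ r) zero (n≮n _)
  dem≡compareExchange (p ∷ q ∷ r) (suc zero) with <-cmp p q
  ... | tri< p<q _ _ = begin
    dem (p ∷ q ∷ r) 1   ≡⟨ dem-ascent (p ∷ q ∷ r) 1 (≤-reflexive (sym (len-swap r p<q))) ⟩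
    q ∷ p ∷ r           ≡⟨ cong₂ (λ m n → m ∷ n ∷ r) (m≤n⇒m⊔n≡n (<⇒≤ p<q)) (m≤n⇒m⊓n≡m (<⇒≤ p<q)) ⟨
    p ⊔ q ∷ p ⊓ q ∷ r   ∎
    where open ≡-Reasoning
  ... | tri≈ _ refl _ = begin
    dem (p ∷ p ∷ r) 1   ≡⟨ dem-stay (p ∷ p ∷ r) 1 (n≮n _) ⟩
    p ∷ p ∷ r           ≡⟨ cong₂ (λ m n → m ∷ n ∷ r) (⊔-idem p) (⊓-idem p) ⟨
    p ⊔ p ∷ p ⊓ p ∷ r   ∎
    where open ≡-Reasoning
  ... | tri> _ _ q<p = begin
    dem (p ∷ q ∷ r) 1   ≡⟨ dem-stay (p ∷ q ∷ r) 1 (<⇒≯ (≤-reflexive (sym (len-swap r q<p)))) ⟩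
    p ∷ q ∷ r           ≡⟨ cong₂ (λ m n → m ∷ n ∷ r) (m≥n⇒m⊔n≡m (<⇒≤ q<p)) (m≥n⇒m⊓n≡n (<⇒≤ q<p)) ⟨
    p ⊔ q ∷ p ⊓ q ∷ r   ∎
    where open ≡-Reasoning
  dem≡compareExchange (p ∷ r) (suc (suc a)) =
    trans (dem-cons p r a) (cong (p ∷_) (dem≡compareExchange r (suc a)))

  foldl-dem≡compareExchange : ∀ v as → foldl dem v as ≡ foldl compareExchange v as
  foldl-dem≡compareExchange v []       = refl
  foldl-dem≡compareExchange v (a ∷ as) = trans (foldl-dem≡compareExchange (dem v a) as)
    (cong (λ u → foldl compareExchange u as) (dem≡compareExchange v a))

  len-foldl-dem-≤ : ∀ v as → len (foldl dem v as) ≤ length as + len v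
  len-foldl-dem-≤ v []       = ≤-refl
  len-foldl-dem-≤ v (a ∷ as) = ≤-trans (len-foldl-dem-≤ (dem v a) as)
    (≤-trans (+-monoʳ-≤ (length as) (len-dem-≤ v a)) (≤-reflexive (+-suc (length as) (len v))))

  compareExchange-zero : ∀ v → compareExchange v 0 ≡ v
  compareExchange-zero []          = refl
  compareExchange-zero (p ∷ [])    = refl
  compareExchange-zero (p ∷ q ∷ r) = refl

  compareExchange-idem : ∀ v a → compareExchange (compareExchange v a) a ≡ compareExchange v a
  compareExchange-idem (p ∷ r)     (suc (suc a)) = cong (p ∷_) (compareExchange-idem r (suc a))
  compareExchange-idem (p ∷ q ∷ r) (suc zero)    =
    cong₂ (λ m n → m ∷ n ∷ r) (m≥n⇒m⊔n≡m (m⊓n≤m⊔n p q)) (m≥n⇒m⊓n≡n (m⊓n≤m⊔n p q))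
  compareExchange-idem []          a             = refl
  compareExchange-idem (p ∷ [])    zero          = refl
  compareExchange-idem (p ∷ [])    (suc zero)    = refl
  compareExchange-idem (p ∷ q ∷ r) zero          = refl

  compareExchange-comm : ∀ v a b → suc (suc a) ≤ b →
    compareExchange (compareExchange v a) b ≡ compareExchange (compareExchange v b) a
  compareExchange-comm v zero b _ = begin
    compareExchange (compareExchange v 0) b ≡⟨ cong (λ u → compareExchange u b) (compareExchange-zero v) ⟩
    compareExchange v b                     ≡⟨ compareExchange-zero (compareExchange v b) ⟨
    compareExchange (compareExchange v b) 0 ∎
    where open ≡-Reasoning
  compareExchange-comm v (suc zero)    (suc zero)       (s≤s ())
  compareExchange-comm v (suc zero)    (suc (suc zero)) (s≤s (s≤s ()))
  compareExchange-comm v (suc (suc a)) (suc zero)       (s≤s ())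
  compareExchange-comm []          (suc zero) (suc (suc (suc b))) _ = refl
  compareExchange-comm (p ∷ [])    (suc zero) (suc (suc (suc b))) _ = refl
  compareExchange-comm (p ∷ q ∷ r) (suc zero) (suc (suc (suc b))) _ = refl
  compareExchange-comm []      (suc (suc a)) (suc (suc b)) _ = refl
  compareExchange-comm (p ∷ r) (suc (suc a)) (suc (suc b)) (s≤s (s≤s h)) =
    cong (p ∷_) (compareExchange-comm r (suc a) (suc b) (s≤s h))

  compareExchange-braid : ∀ v a →
    compareExchange (compareExchange (compareExchange v a) (suc a)) a
      ≡ compareExchange (compareExchange (compareExchange v (suc a)) a) (suc a)
  compareExchange-braid v zero = begin
    compareExchange (compareExchange (compareExchange v 0) 1) 0 ≡⟨ compareExchange-zero (compareExchange (compareExchange v 0) 1) ⟩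
    compareExchange (compareExchange v 0) 1                     ≡⟨ cong (λ u → compareExchange u 1) (compareExchange-zero v) ⟩
    compareExchange v 1                                         ≡⟨ compareExchange-idem v 1 ⟨
    compareExchange (compareExchange v 1) 1                     ≡⟨ cong (λ u → compareExchange u 1) (compareExchange-zero (compareExchange v 1)) ⟨
    compareExchange (compareExchange (compareExchange v 1) 0) 1 ∎
    where open ≡-Reasoning
  compareExchange-braid []              (suc zero) = refl
  compareExchange-braid (p ∷ [])        (suc zero) = refl
  compareExchange-braid (p ∷ q ∷ [])    (suc zero) = compareExchange-idem (p ∷ q ∷ []) 1
  compareExchange-braid (p ∷ q ∷ s ∷ r) (suc zero) =
    cong₂ _∷_ top (cong₂ (λ m n → m ∷ n ∷ r) middle bottom)
    where
    open ≡-Reasoning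
    top : (p ⊔ q) ⊔ ((p ⊓ q) ⊔ s) ≡ p ⊔ (q ⊔ s)
    top = begin
      (p ⊔ q) ⊔ ((p ⊓ q) ⊔ s) ≡⟨ ⊔-assoc (p ⊔ q) (p ⊓ q) s ⟨
      ((p ⊔ q) ⊔ (p ⊓ q)) ⊔ s ≡⟨ cong (_⊔ s) (m≥n⇒m⊔n≡m (m⊓n≤m⊔n p q)) ⟩
      (p ⊔ q) ⊔ s             ≡⟨ ⊔-assoc p q s ⟩
      p ⊔ (q ⊔ s)             ∎
    middle : (p ⊔ q) ⊓ ((p ⊓ q) ⊔ s) ≡ (p ⊓ (q ⊔ s)) ⊔ (q ⊓ s)
    middle = begin
      (p ⊔ q) ⊓ ((p ⊓ q) ⊔ s)               ≡⟨ ⊓-distribˡ-⊔ (p ⊔ q) (p ⊓ q) s ⟩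
      ((p ⊔ q) ⊓ (p ⊓ q)) ⊔ ((p ⊔ q) ⊓ s)   ≡⟨ cong₂ _⊔_ (m≥n⇒m⊓n≡n (m⊓n≤m⊔n p q)) (⊓-distribʳ-⊔ s p q) ⟩
      (p ⊓ q) ⊔ ((p ⊓ s) ⊔ (q ⊓ s))         ≡⟨ ⊔-assoc (p ⊓ q) (p ⊓ s) (q ⊓ s) ⟨
      ((p ⊓ q) ⊔ (p ⊓ s)) ⊔ (q ⊓ s)         ≡⟨ cong (_⊔ (q ⊓ s)) (⊓-distribˡ-⊔ p q s) ⟨
      (p ⊓ (q ⊔ s)) ⊔ (q ⊓ s)               ∎
    bottom : (p ⊓ q) ⊓ s ≡ (p ⊓ (q ⊔ s)) ⊓ (q ⊓ s)
    bottom = begin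
      (p ⊓ q) ⊓ s             ≡⟨ ⊓-assoc p q s ⟩
      p ⊓ (q ⊓ s)             ≡⟨ cong (p ⊓_) (m≥n⇒m⊓n≡n (m⊓n≤m⊔n q s)) ⟨
      p ⊓ ((q ⊔ s) ⊓ (q ⊓ s)) ≡⟨ ⊓-assoc p (q ⊔ s) (q ⊓ s) ⟨
      (p ⊓ (q ⊔ s)) ⊓ (q ⊓ s) ∎
  compareExchange-braid []      (suc (suc a)) = refl
  compareExchange-braid (p ∷ r) (suc (suc a)) = cong (p ∷_) (compareExchange-braid r (suc a))

  range : ℕ → ℕ → List ℕ
  range i zero    = []
  range i (suc t) = i ∷ range (suc i) t

  range-+ : ∀ i s t → range i (s + t) ≡ range i s ++ range (i + s) t
  range-+ i zero    t = cong (λ j → range j t) (sym (+-identityʳ i))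
  range-+ i (suc s) t = cong (i ∷_) (trans (range-+ (suc i) s t) (cong (λ j → range (suc i) s ++ range j t) (sym (+-suc i s))))

  range-snoc : ∀ i t → range i (suc t) ≡ range i t ++ i + t ∷ []
  range-snoc i t = trans (cong (range i) (+-comm 1 t)) (range-+ i t 1)

  ∈-range : ∀ {i t j} → j ∈ range i t → i ≤ j × j < i + t
  ∈-range {i} {suc t} (here refl) = ≤-refl , m<m+n i z<s
  ∈-range {i} {suc t} {j} (there j∈) with ∈-range j∈
  ... | i<j , j<1+i+t = <⇒≤ i<j , subst (j <_) (sym (+-suc i t)) j<1+i+t

  map-suc-upTo : ∀ n → map suc (upTo n) ≡ range 1 n
  map-suc-upTo n = trans (map-upTo suc n) (go suc 1 n (λ _ → refl))
    where
    go : ∀ f i t → (∀ j → f j ≡ i + j) → applyUpTo f t ≡ range i t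
    go f i zero    _ = refl
    go f i (suc t) e = cong₂ _∷_ (trans (e 0) (+-identityʳ i)) (go (f ∘ suc) (suc i) t (λ j → trans (e (suc j)) (+-suc i j)))

  len-range : ∀ i t → len (range i t) ≡ 0
  len-range i zero    = refl
  len-range i (suc t) = cong₂ _+_ below-i (len-range (suc i) t)
    where
    below-i : below i (range (suc i) t) ≡ 0
    below-i = cong length (filter-none (_<? i) {range (suc i) t} (All.tabulate (λ j∈ → <⇒≯ (proj₁ (∈-range {suc i} {t} j∈)))))

  len-idPerm : ∀ n → len (idPerm n) ≡ 0
  len-idPerm n = trans (cong len (map-suc-upTo n)) (len-range 1 n)

  idPerm-suc : ∀ m → idPerm (suc m) ≡ idPerm m ++ [ suc m ]
  idPerm-suc m = trans (map-suc-upTo (suc m)) (trans (range-snoc 1 m) (cong (_++ [ suc m ]) (sym (map-suc-upTo m))))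

  <⇒<suc[∸1] : ∀ {i n} → i < n → i < suc (n ∸ 1)
  <⇒<suc[∸1] {n = suc n} i<n = i<n

  ≤∸1-split : ∀ {m n} → suc m ≤ n ∸ 1 → n ≡ m + suc (suc (n ∸ suc (suc m)))
  ≤∸1-split {m} {suc n} 1+m≤n = begin
    suc n                   ≡⟨ cong suc (m+[n∸m]≡n 1+m≤n) ⟨
    suc (suc (m + t))       ≡⟨ cong suc (+-suc m t) ⟨
    suc (m + suc t)         ≡⟨ +-suc m (suc t) ⟨
    m + suc (suc t)         ∎
    where
    open ≡-Reasoning
    t = n ∸ suc m

  ∸-split : ∀ d {C E l l′ L} → C ≡ d + suc E → l′ ≤ suc l → L ≤ E + l′ →
    (C + l) ∸ L ≡ (d + (suc l ∸ l′)) + ((E + l′) ∸ L)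
  ∸-split d {E = E} {l} {l′} {L} refl l′≤1+l L≤ = trans (cong (_∸ L) arith) (+-∸-assoc (d + x) L≤)
    where
    open ≡-Reasoning
    x = suc l ∸ l′
    arith : d + suc E + l ≡ (d + x) + (E + l′)
    arith = begin
      d + suc E + l      ≡⟨ +-assoc d (suc E) l ⟩
      d + suc (E + l)    ≡⟨ cong (d +_) (+-suc E l) ⟨
      d + (E + suc l)    ≡⟨ cong (λ m → d + (E + m)) (m∸n+n≡m l′≤1+l) ⟨
      d + (E + (x + l′)) ≡⟨ cong (d +_) (x∙yz≈y∙xz E x l′) ⟩
      d + (x + (E + l′)) ≡⟨ +-assoc d x (E + l′) ⟨
      (d + x) + (E + l′) ∎

  card-∨ : ∀ px py → card (zipWith _∨_ px py) ≤ card px + card py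
  card-∨ []           py           = z≤n
  card-∨ (b ∷ px)     []           = z≤n
  card-∨ (true ∷ px)  (true ∷ py)  = s≤s (≤-trans (card-∨ px py) (+-monoʳ-≤ (card px) (n≤1+n (card py))))
  card-∨ (true ∷ px)  (false ∷ py) = s≤s (card-∨ px py)
  card-∨ (false ∷ px) (true ∷ py)  = ≤-trans (s≤s (card-∨ px py)) (≤-reflexive (sym (+-suc (card px) (card py))))
  card-∨ (false ∷ px) (false ∷ py) = card-∨ px py

open Permutations

module DemazureOperators {c ℓ} (R : CommutativeRing c ℓ) (β : CommutativeRing.Carrier R) where

  open import Level using (_⊔_)
  open import Function using (id; _∘_)
  import Data.Nat as ℕ
  open import Data.Nat using (zero; _≤_; _<_; _<?_; _≟_) renaming (_+_ to _+ℕ_)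
  import Data.Nat.Properties as ℕₚ
  open ℕₚ using (≤-refl; ≤-reflexive; ≤-trans; n∸n≡0; +-∸-assoc)
  open import Data.Bool using (Bool; true; false; _∨_; _∧_)
  open import Data.List using ([]; _∷_; _++_; [_]; length; foldl; foldr; downFrom; concatMap; concat; zip; zipWith)
  open import Data.List.Properties using (≡-dec; ++-identityʳ; concatMap-cong; concatMap-++; map-cong-local; map-concatMap; foldl-cong)
  open import Data.List.Membership.Propositional using (_∉_)
  open import Data.List.Membership.Propositional.Properties using (∈-map⁻; ∈-∃++; ∈-++⁺ˡ; ∈-++⁺ʳ)
  import Data.List.Relation.Unary.All as All
  open import Data.List.Relation.Unary.Any using (here; there)
  open import Data.List.Relation.Binary.Permutation.Propositional using (_↭_; ↭-sym; ↭-refl; ↭-trans)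
  open import Data.List.Relation.Binary.Permutation.Propositional.Properties using (↭-empty-inv; ∈-resp-↭; drop-mid)
  open import Data.Sum using (inj₁; inj₂)
  open import Relation.Binary.Bundles using (Setoid)
  open import Relation.Binary.PropositionalEquality as ≡ using (_≡_; _≢_)
  import Relation.Binary.Reasoning.Setoid as SetoidReasoning
  open import Relation.Nullary using (does; yes; no)
  open import Relation.Nullary.Decidable using (dec-true; dec-false)

  open CommutativeRing R
  open Poly R using (pow; sumL; shift; prodCells; G; weight)
  open import Algebra.Solver.Ring.NaturalCoefficients.Default commutativeSemiring using (solve; _:+_; _:*_; _:=_; con)

  module ≈-Reasoning = SetoidReasoning setoid

  sumL-++ : ∀ {A : Set} (l₁ l₂ : List A) f → sumL (l₁ ++ l₂) f ≈ sumL l₁ f + sumL l₂ f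
  sumL-++ []       l₂ f = sym (+-identityˡ _)
  sumL-++ (a ∷ l₁) l₂ f = trans (+-congˡ (sumL-++ l₁ l₂ f)) (sym (+-assoc _ _ _))

  sumL-map : ∀ {A B : Set} (f : A → B) l g → sumL (map f l) g ≡ sumL l (g ∘ f)
  sumL-map f []      g = ≡.refl
  sumL-map f (a ∷ l) g = ≡.cong (g (f a) +_) (sumL-map f l g)

  sumL-cong : ∀ {A : Set} (l : List A) {f g} → (∀ a → f a ≈ g a) → sumL l f ≈ sumL l g
  sumL-cong []      f≈g = refl
  sumL-cong (a ∷ l) f≈g = +-cong (f≈g a) (sumL-cong l f≈g)

  sumL-+ : ∀ {A : Set} (l : List A) f g → sumL l (λ a → f a + g a) ≈ sumL l f + sumL l g
  sumL-+ []      f g = sym (+-identityʳ 0#)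
  sumL-+ (a ∷ l) f g = trans (+-congˡ (sumL-+ l f g))
    (solve 4 (λ p q r s → (p :+ q) :+ (r :+ s) := (p :+ r) :+ (q :+ s)) refl (f a) (g a) (sumL l f) (sumL l g))

  sumL-* : ∀ {A : Set} (l : List A) k f → sumL l (λ a → k * f a) ≈ k * sumL l f
  sumL-* []      k f = sym (zeroʳ k)
  sumL-* (a ∷ l) k f = trans (+-congˡ (sumL-* l k f)) (sym (distribˡ k _ _))

  sumL-zero : ∀ {A : Set} (L : List A) {f} → (∀ a → f a ≡ 0#) → sumL L f ≈ 0#
  sumL-zero []      f≡0 = refl
  sumL-zero (a ∷ L) f≡0 = trans (+-cong (reflexive (f≡0 a)) (sumL-zero L f≡0)) (+-identityʳ 0#)

  sumL-concatMap : ∀ {A B : Set} (f : A → List B) L g → sumL (concatMap f L) g ≈ sumL L (λ a → sumL (f a) g)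
  sumL-concatMap f []      g = refl
  sumL-concatMap f (a ∷ L) g = trans (sumL-++ (f a) (concatMap f L) g) (+-congˡ (sumL-concatMap f L g))

  sumL-cartesianProduct : ∀ {A B : Set} (L : List A) (K : List B) f →
    sumL (cartesianProduct L K) f ≈ sumL L (λ a → sumL K (λ b → f (a , b)))
  sumL-cartesianProduct []      K f = refl
  sumL-cartesianProduct (a ∷ L) K f = trans (sumL-++ (map (a ,_) K) (cartesianProduct L K) f)
    (+-cong (reflexive (sumL-map (a ,_) K f)) (sumL-cartesianProduct L K f))

  sumL-swap : ∀ {A B : Set} (L : List A) (K : List B) (f : A → B → Carrier) →
    sumL L (λ a → sumL K (f a)) ≈ sumL K (λ b → sumL L (λ a → f a b))
  sumL-swap []      K f = sym (sumL-zero K (λ _ → ≡.refl))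
  sumL-swap (a ∷ L) K f = trans (+-congˡ (sumL-swap L K f)) (sym (sumL-+ K (f a) _))

  sum² : ∀ {A : Set} → List A → (A → A → Carrier) → Carrier
  sum² l f = sumL l λ a → sumL l λ b → f a b

  sum²-* : ∀ {A : Set} (l : List A) k {f g} → (∀ a b → f a b ≈ k * g a b) → sum² l f ≈ k * sum² l g
  sum²-* l k f≈kg = trans (sumL-cong l (λ a → trans (sumL-cong l (f≈kg a)) (sumL-* l k _))) (sumL-* l k _)

  sum²-masks : ∀ m f → sum² (masks (suc m)) f ≈
    (sum² (masks m) (λ px py → f (true ∷ px) (true ∷ py)) + sum² (masks m) (λ px py → f (true ∷ px) (false ∷ py)))
      + (sum² (masks m) (λ px py → f (false ∷ px) (true ∷ py)) + sum² (masks m) (λ px py → f (false ∷ px) (false ∷ py)))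
  sum²-masks m f = trans (split (λ px → sumL (masks (suc m)) (f px)))
                         (+-cong (trans (sumL-cong M (λ px → split (f (true ∷ px)))) (sumL-+ M _ _))
                                 (trans (sumL-cong M (λ px → split (f (false ∷ px)))) (sumL-+ M _ _)))
    where
    M = masks m
    split : ∀ g → sumL (masks (suc m)) g ≈ sumL M (g ∘ (true ∷_)) + sumL M (g ∘ (false ∷_))
    split g = trans (sumL-++ (map (true ∷_) M) _ g) (reflexive (≡.cong₂ _+_ (sumL-map (true ∷_) M g) (sumL-map (false ∷_) M g)))

  sumL-range-snoc : ∀ m f → sumL (range 1 (suc m)) f ≈ sumL (range 1 m) f + f (suc m)
  sumL-range-snoc m f = begin
    sumL (range 1 (suc m)) f              ≡⟨ ≡.cong (λ L → sumL L f) (range-snoc 1 m) ⟩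
    sumL (range 1 m ++ [ suc m ]) f       ≈⟨ sumL-++ (range 1 m) [ suc m ] f ⟩
    sumL (range 1 m) f + (f (suc m) + 0#) ≈⟨ +-congˡ (+-identityʳ _) ⟩
    sumL (range 1 m) f + f (suc m)        ∎
    where open ≈-Reasoning

  -- β-Demazure operators on functions of permutations

  Fun : Set c
  Fun = List ℕ → Carrier

  infix 4 _≐_
  _≐_ : Fun → Fun → Set ℓ
  F ≐ G = ∀ v → F v ≈ G v

  Fun-setoid : Setoid c ℓ
  Fun-setoid = record
    { Carrier = Fun
    ; _≈_ = _≐_
    ; isEquivalence = record { refl = λ _ → refl ; sym = λ e v → sym (e v) ; trans = λ e f v → trans (e v) (f v) }
    }

  module ≐-Reasoning = SetoidReasoning Fun-setoid

  pow-+ : ∀ m n → pow β (m +ℕ n) ≈ pow β m * pow β n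
  pow-+ zero    n = sym (*-identityˡ _)
  pow-+ (suc m) n = trans (*-congˡ (pow-+ m n)) (sym (*-assoc β _ _))

  π : ℕ → Fun → Fun
  π a F v = pow β (suc (len v) ∸ len (dem v a)) * F (dem v a)

  πs : List ℕ → Fun → Fun
  πs as F = foldr π F as

  πs-closed-form : ∀ as F v → πs as F v ≈ pow β ((length as +ℕ len v) ∸ len (foldl dem v as)) * F (foldl dem v as)
  πs-closed-form [] F v = begin
    F v                                ≈⟨ *-identityˡ (F v) ⟨
    1# * F v                           ≡⟨ ≡.cong (λ e → pow β e * F v) (n∸n≡0 (len v)) ⟨
    pow β (len v ∸ len v) * F v        ∎
    where open ≈-Reasoning
  πs-closed-form (a ∷ as) F v = begin
    pow β (suc (len v) ∸ len w) * πs as F w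
      ≈⟨ *-congˡ (πs-closed-form as F w) ⟩
    pow β (suc (len v) ∸ len w) * (pow β ((length as +ℕ len w) ∸ len e) * F e)
      ≈⟨ *-assoc _ _ _ ⟨
    pow β (suc (len v) ∸ len w) * pow β ((length as +ℕ len w) ∸ len e) * F e
      ≈⟨ *-congʳ (pow-+ (suc (len v) ∸ len w) ((length as +ℕ len w) ∸ len e)) ⟨
    pow β ((suc (len v) ∸ len w) +ℕ ((length as +ℕ len w) ∸ len e)) * F e
      ≡⟨ ≡.cong (λ n → pow β n * F e) (∸-split 0 ≡.refl (len-dem-≤ v a) (len-foldl-dem-≤ w as)) ⟨
    pow β ((suc (length as) +ℕ len v) ∸ len e) * F e ∎
    where
    open ≈-Reasoning
    w = dem v a
    e = foldl dem w as

  πs-same-endpoint : ∀ as bs d F v → foldl compareExchange v as ≡ foldl compareExchange v bs →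
    length as ≡ d +ℕ length bs → πs as F v ≈ pow β d * πs bs F v
  πs-same-endpoint as bs d F v same-end same-length = begin
    πs as F v
      ≈⟨ πs-closed-form as F v ⟩
    pow β ((length as +ℕ len v) ∸ len e) * F e
      ≡⟨ ≡.cong₂ (λ n u → pow β ((n +ℕ len v) ∸ len u) * F u) same-length end ⟩
    pow β ((d +ℕ length bs +ℕ len v) ∸ len e′) * F e′
      ≡⟨ ≡.cong (λ n → pow β (n ∸ len e′) * F e′) (ℕₚ.+-assoc d (length bs) (len v)) ⟩
    pow β ((d +ℕ (length bs +ℕ len v)) ∸ len e′) * F e′
      ≡⟨ ≡.cong (λ n → pow β n * F e′) (+-∸-assoc d (len-foldl-dem-≤ v bs)) ⟩
    pow β (d +ℕ ((length bs +ℕ len v) ∸ len e′)) * F e′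
      ≈⟨ trans (*-congʳ (pow-+ d _)) (*-assoc _ _ _) ⟩
    pow β d * (pow β ((length bs +ℕ len v) ∸ len e′) * F e′)
      ≈⟨ *-congˡ (πs-closed-form bs F v) ⟨
    pow β d * πs bs F v ∎
    where
    open ≈-Reasoning
    e  = foldl dem v as
    e′ = foldl dem v bs
    end : e ≡ e′
    end = ≡.trans (foldl-dem≡compareExchange v as) (≡.trans same-end (≡.sym (foldl-dem≡compareExchange v bs)))

  π-idem : ∀ a F → π a (π a F) ≐ λ v → β * π a F v
  π-idem a F v = trans (πs-same-endpoint (a ∷ a ∷ []) (a ∷ []) 1 F v (compareExchange-idem v a) ≡.refl)
                       (*-congʳ (*-identityʳ β))

  π-comm : ∀ {a b} → suc (suc a) ≤ b → ∀ F → π a (π b F) ≐ π b (π a F)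
  π-comm {a} {b} a+2≤b F v = trans (πs-same-endpoint (a ∷ b ∷ []) (b ∷ a ∷ []) 0 F v (compareExchange-comm v a b a+2≤b) ≡.refl)
                                   (*-identityˡ _)

  π-braid : ∀ a F → π a (π (suc a) (π a F)) ≐ π (suc a) (π a (π (suc a) F))
  π-braid a F v = trans (πs-same-endpoint (a ∷ suc a ∷ a ∷ []) (suc a ∷ a ∷ suc a ∷ []) 0 F v (compareExchange-braid v a) ≡.refl)
                        (*-identityˡ _)

  -- Linear operators, and the generators h_a(z) = 1 + z π_a

  record IsLinear (T : Fun → Fun) : Set (c ⊔ ℓ) where
    field
      cong  : ∀ {F G} → F ≐ G → T F ≐ T G
      +-hom : ∀ F G → T (λ u → F u + G u) ≐ λ v → T F v + T G v
      *-hom : ∀ k F → T (λ u → k * F u) ≐ λ v → k * T F v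

  open IsLinear

  id-linear : IsLinear id
  id-linear = record { cong = id ; +-hom = λ _ _ _ → refl ; *-hom = λ _ _ _ → refl }

  ∘-linear : ∀ {S T} → IsLinear S → IsLinear T → IsLinear (S ∘ T)
  ∘-linear {S} {T} S-lin T-lin = record
    { cong  = λ e → cong S-lin (cong T-lin e)
    ; +-hom = λ F G v → trans (cong S-lin (+-hom T-lin F G) v) (+-hom S-lin (T F) (T G) v)
    ; *-hom = λ k F v → trans (cong S-lin (*-hom T-lin k F) v) (*-hom S-lin k (T F) v)
    }

  π-linear : ∀ a → IsLinear (π a)
  π-linear a = record
    { cong  = λ e v → *-congˡ (e (dem v a))
    ; +-hom = λ F G v → distribˡ _ (F (dem v a)) (G (dem v a))
    ; *-hom = λ k F v → x∙yz≈y∙xz _ k (F (dem v a))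
    }
    where open import Algebra.Properties.CommutativeSemigroup *-commutativeSemigroup using (x∙yz≈y∙xz)

  linear-sumL : ∀ {T} → IsLinear T → ∀ {A : Set} (L : List A) (f : A → Fun) →
    T (λ v → sumL L (λ a → f a v)) ≐ λ v → sumL L (λ a → T (f a) v)
  linear-sumL {T} T-lin [] f v = begin
    T (λ _ → 0#) v      ≈⟨ cong T-lin (λ _ → sym (zeroˡ 0#)) v ⟩
    T (λ _ → 0# * 0#) v ≈⟨ *-hom T-lin 0# (λ _ → 0#) v ⟩
    0# * T (λ _ → 0#) v ≈⟨ zeroˡ _ ⟩
    0#                  ∎
    where open ≈-Reasoning
  linear-sumL     T-lin (a ∷ L) f v = trans (+-hom T-lin (f a) _ v) (+-congˡ (linear-sumL T-lin L f v))

  h : ℕ → Carrier → Fun → Fun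
  h a z F v = F v + z * π a F v

  h-expand : ∀ {T} → IsLinear T → ∀ a z F → T (h a z F) ≐ λ v → T F v + z * T (π a F) v
  h-expand T-lin a z F v = trans (+-hom T-lin F _ v) (+-congˡ (*-hom T-lin z (π a F) v))

  h-linear : ∀ a z → IsLinear (h a z)
  h-linear a z = record
    { cong  = λ e v → +-cong (e v) (*-congˡ (cong (π-linear a) e v))
    ; +-hom = λ F G v → trans (+-congˡ (*-congˡ (+-hom (π-linear a) F G v)))
                              (solve 5 (λ f g z p q → f :+ g :+ z :* (p :+ q) := f :+ z :* p :+ (g :+ z :* q)) refl (F v) (G v) z _ _)
    ; *-hom = λ k F v → trans (+-congˡ (*-congˡ (*-hom (π-linear a) k F v)))
                              (solve 4 (λ k f z p → k :* f :+ z :* (k :* p) := k :* (f :+ z :* p)) refl k (F v) z _)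
    }

  h-cong : ∀ a {z z′ F G} → z ≈ z′ → F ≐ G → h a z F ≐ h a z′ G
  h-cong a z≈z′ F≐G v = +-cong (F≐G v) (*-cong z≈z′ (cong (π-linear a) F≐G v))

  h²-expand : ∀ {T} → IsLinear T → ∀ a p b q F → T (h a p (h b q F)) ≐ λ v →
    (T F v + q * T (π b F) v) + p * (T (π a F) v + q * T (π a (π b F)) v)
  h²-expand T-lin a p b q F v = trans (h-expand T-lin a p (h b q F) v)
    (+-cong (h-expand T-lin b q F v) (*-congˡ (h-expand (∘-linear T-lin (π-linear a)) b q F v)))

  h³-expand : ∀ a p b q c r F → h a p (h b q (h c r F)) ≐ λ v →
    ((F v + r * π c F v) + q * (π b F v + r * π b (π c F) v))
      + p * ((π a F v + r * π a (π c F) v) + q * (π a (π b F) v + r * π a (π b (π c F)) v))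
  h³-expand a p b q c r F v = trans (h-expand id-linear a p (h b q (h c r F)) v)
    (+-cong (h²-expand id-linear b q c r F v) (*-congˡ (h²-expand (π-linear a) b q c r F v)))

  -- The formal group law of connective K-theory.
  infixl 6 _⊕_
  _⊕_ : Carrier → Carrier → Carrier
  p ⊕ q = p + q + β * (p * q)

  ⊕-identityˡ : ∀ b → 0# ⊕ b ≈ b
  ⊕-identityˡ b = solve 2 (λ b β → con 0 :+ b :+ β :* (con 0 :* b) := b) refl b β

  h-merge : ∀ a p q F → h a p (h a q F) ≐ h a (q ⊕ p) F
  h-merge a p q F v = begin
    h a p (h a q F) v                                   ≈⟨ h²-expand id-linear a p a q F v ⟩
    (F v + q * π a F v) + p * (π a F v + q * π a (π a F) v) ≈⟨ +-congˡ (*-congˡ (+-congˡ (*-congˡ (π-idem a F v)))) ⟩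
    (F v + q * π a F v) + p * (π a F v + q * (β * π a F v)) ≈⟨ solve 5 (λ f P p q b → (f :+ q :* P) :+ p :* (P :+ q :* (b :* P)) := f :+ (q :+ p :+ b :* (q :* p)) :* P) refl (F v) (π a F v) p q β ⟩
    h a (q ⊕ p) F v                                     ∎
    where open ≈-Reasoning

  h-comm : ∀ {a b} → suc (suc a) ≤ b → ∀ p q F → h a p (h b q F) ≐ h b q (h a p F)
  h-comm {a} {b} a+2≤b p q F v = begin
    h a p (h b q F) v                                       ≈⟨ h²-expand id-linear a p b q F v ⟩
    (F v + q * π b F v) + p * (π a F v + q * π a (π b F) v) ≈⟨ +-congˡ (*-congˡ (+-congˡ (*-congˡ (π-comm a+2≤b F v)))) ⟩
    (F v + q * π b F v) + p * (π a F v + q * π b (π a F) v) ≈⟨ solve 6 (λ f A B AB p q → (f :+ q :* B) :+ p :* (A :+ q :* AB) := (f :+ p :* A) :+ q :* (B :+ p :* AB)) refl (F v) (π a F v) (π b F v) (π b (π a F) v) p q ⟩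
    (F v + p * π a F v) + q * (π b F v + p * π b (π a F) v) ≈⟨ h²-expand id-linear b q a p F v ⟨
    h b q (h a p F) v                                       ∎
    where open ≈-Reasoning

  h-ybe : ∀ a u w F → h (suc a) w (h a (w ⊕ u) (h (suc a) u F)) ≐ h a u (h (suc a) (w ⊕ u) (h a w F))
  h-ybe a u w F v = begin
    h b w (h a s (h b u F)) v
      ≈⟨ h³-expand b w a s b u F v ⟩
    ((f + u * B) + s * (A + u * AB)) + w * ((B + u * π b (π b F) v) + s * (BA + u * BAB))
      ≈⟨ +-congˡ (*-congˡ (+-congʳ (+-congˡ (*-congˡ (π-idem b F v))))) ⟩
    ((f + u * B) + s * (A + u * AB)) + w * ((B + u * (β * B)) + s * (BA + u * BAB))
      ≈⟨ solve 9 (λ f A B AB BA BAB u w b →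
           let s = w :+ u :+ b :* (w :* u) in
           ((f :+ u :* B) :+ s :* (A :+ u :* AB)) :+ w :* ((B :+ u :* (b :* B)) :+ s :* (BA :+ u :* BAB))
           := ((f :+ w :* A) :+ s :* (B :+ w :* BA)) :+ u :* ((A :+ w :* (b :* A)) :+ s :* (AB :+ w :* BAB)))
         refl f A B AB BA BAB u w β ⟩
    ((f + w * A) + s * (B + w * BA)) + u * ((A + w * (β * A)) + s * (AB + w * BAB))
      ≈⟨ +-congˡ (*-congˡ (+-cong (+-congˡ (*-congˡ (π-idem a F v))) (*-congˡ (+-congˡ (*-congˡ (π-braid a F v)))))) ⟨
    ((f + w * A) + s * (B + w * BA)) + u * ((A + w * π a (π a F) v) + s * (AB + w * π a (π b (π a F)) v))
      ≈⟨ h³-expand a u b s a w F v ⟨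
    h a u (h b s (h a w F)) v ∎
    where
    open ≈-Reasoning
    b = suc a
    s = w ⊕ u
    f = F v
    A = π a F v
    B = π b F v
    AB = π a (π b F) v
    BA = π b (π a F) v
    BAB = π b (π a (π b F)) v

  -- Words of generators and the staircase

  Word : Set c
  Word = List (ℕ × Carrier)

  ⟦_⟧ : Word → Fun → Fun
  ⟦ [] ⟧          F = F
  ⟦ (a , z) ∷ W ⟧ F = h a z (⟦ W ⟧ F)

  ⟦⟧-++ : ∀ W W′ F → ⟦ W ++ W′ ⟧ F ≡ ⟦ W ⟧ (⟦ W′ ⟧ F)
  ⟦⟧-++ []            W′ F = ≡.refl
  ⟦⟧-++ ((a , z) ∷ W) W′ F = ≡.cong (h a z) (⟦⟧-++ W W′ F)

  ⟦⟧-linear : ∀ W → IsLinear ⟦ W ⟧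
  ⟦⟧-linear []            = id-linear
  ⟦⟧-linear ((a , z) ∷ W) = ∘-linear (h-linear a z) (⟦⟧-linear W)

  ⟦⟧-cong : ∀ W {F G} → F ≐ G → ⟦ W ⟧ F ≐ ⟦ W ⟧ G
  ⟦⟧-cong W = cong (⟦⟧-linear W)

  ⟦⟧-local : ∀ W {F G} v → (∀ u → u ↭ v → F u ≈ G u) → ⟦ W ⟧ F v ≈ ⟦ W ⟧ G v
  ⟦⟧-local []            v F≈G = F≈G v ↭-refl
  ⟦⟧-local ((a , z) ∷ W) v F≈G = +-cong (⟦⟧-local W v F≈G)
    (*-congˡ (*-congˡ (⟦⟧-local W (dem v a) (λ u u↭ → F≈G u (↭-trans u↭ (dem-↭ v a))))))

  row : ℕ → (ℕ → Carrier) → ℕ → Word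
  row k c zero    = []
  row k c (suc m) = (k +ℕ m , c (suc m)) ∷ row k c m

  row-snoc : ∀ k c m → row k c (suc m) ≡ row (suc k) (c ∘ suc) m ++ [ (k , c 1) ]
  row-snoc k c zero    = ≡.cong (λ a → [ (a , c 1) ]) (ℕₚ.+-identityʳ k)
  row-snoc k c (suc m) = ≡.cong₂ (λ a W → (a , c (suc (suc m))) ∷ W) (ℕₚ.+-suc k m) (row-snoc k c m)

  ⟦row⟧-snoc : ∀ k c m F → ⟦ row k c (suc m) ⟧ F ≡ ⟦ row (suc k) (c ∘ suc) m ⟧ (h k (c 1) F)
  ⟦row⟧-snoc k c m F = ≡.trans (≡.cong (λ W → ⟦ W ⟧ F) (row-snoc k c m)) (⟦⟧-++ (row (suc k) (c ∘ suc) m) _ F)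

  row-cong : ∀ k m {c c′} → (∀ j → c j ≈ c′ j) → ∀ F → ⟦ row k c m ⟧ F ≐ ⟦ row k c′ m ⟧ F
  row-cong k zero    c≈c′ F = λ _ → refl
  row-cong k (suc m) c≈c′ F = h-cong (k +ℕ m) (c≈c′ (suc m)) (row-cong k m c≈c′ F)

  h-row-comm : ∀ {a k} → suc (suc a) ≤ k → ∀ z c m F → h a z (⟦ row k c m ⟧ F) ≐ ⟦ row k c m ⟧ (h a z F)
  h-row-comm a+2≤k z c zero    F = λ _ → refl
  h-row-comm {a} {k} a+2≤k z c (suc m) F v = trans
    (h-comm (≤-trans a+2≤k (ℕₚ.m≤m+n k m)) z (c (suc m)) (⟦ row k c m ⟧ F) v)
    (cong (h-linear (k +ℕ m) (c (suc m))) (h-row-comm a+2≤k z c m F) v)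

  -- Train argument: h k z travels left through row suc k, each Yang-Baxter move transferring z
  -- from a coefficient of row suc k to the matching one of row k, until h-merge absorbs it.
  rows-exchange : ∀ k m c z F →
    ⟦ row k (λ j → z ⊕ c j) (suc m) ⟧ (⟦ row (suc k) c m ⟧ F)
      ≐ ⟦ row k c (suc m) ⟧ (⟦ row (suc k) (λ j → z ⊕ c j) m ⟧ (h k z F))
  rows-exchange k zero c z F = begin
    ⟦ row k (λ j → z ⊕ c j) 1 ⟧ F  ≡⟨ ⟦row⟧-snoc k (λ j → z ⊕ c j) 0 F ⟩
    h k (z ⊕ c 1) F               ≈⟨ h-merge k (c 1) z F ⟨
    h k (c 1) (h k z F)           ≡⟨ ⟦row⟧-snoc k c 0 (h k z F) ⟨
    ⟦ row k c 1 ⟧ (h k z F)       ∎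
    where open ≐-Reasoning
  rows-exchange k (suc m) c z F = begin
    ⟦ row k zc (2 +ℕ m) ⟧ (⟦ row (suc k) c (suc m) ⟧ F)
      ≡⟨ ⟦row⟧-snoc k zc (suc m) _ ⟩
    ⟦ A₁ ⟧ (h k (zc 1) (⟦ row (suc k) c (suc m) ⟧ F))
      ≡⟨ ≡.cong (λ G → ⟦ A₁ ⟧ (h k (zc 1) G)) (⟦row⟧-snoc (suc k) c m F) ⟩
    ⟦ A₁ ⟧ (h k (zc 1) (⟦ B₁ ⟧ (h (suc k) (c 1) F)))
      ≈⟨ ⟦⟧-cong A₁ (h-row-comm ≤-refl (zc 1) (c ∘ suc) m _) ⟩
    ⟦ A₁ ⟧ (⟦ B₁ ⟧ (h k (zc 1) (h (suc k) (c 1) F)))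
      ≈⟨ rows-exchange (suc k) m (c ∘ suc) z _ ⟩
    ⟦ A₂ ⟧ (⟦ B₂ ⟧ (h (suc k) z (h k (zc 1) (h (suc k) (c 1) F))))
      ≈⟨ ⟦⟧-cong A₂ (⟦⟧-cong B₂ (h-ybe k (c 1) z F)) ⟩
    ⟦ A₂ ⟧ (⟦ B₂ ⟧ (h k (c 1) (h (suc k) (zc 1) (h k z F))))
      ≈⟨ ⟦⟧-cong A₂ (h-row-comm ≤-refl (c 1) (zc ∘ suc) m _) ⟨
    ⟦ A₂ ⟧ (h k (c 1) (⟦ B₂ ⟧ (h (suc k) (zc 1) (h k z F))))
      ≡⟨ ⟦row⟧-snoc k c (suc m) _ ⟨
    ⟦ row k c (2 +ℕ m) ⟧ (⟦ B₂ ⟧ (h (suc k) (zc 1) (h k z F)))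
      ≡⟨ ≡.cong ⟦ row k c (2 +ℕ m) ⟧ (⟦row⟧-snoc (suc k) zc m (h k z F)) ⟨
    ⟦ row k c (2 +ℕ m) ⟧ (⟦ row (suc k) zc (suc m) ⟧ (h k z F)) ∎
    where
    open ≐-Reasoning
    zc : ℕ → Carrier
    zc j = z ⊕ c j
    A₁ = row (suc k) (zc ∘ suc) (suc m)
    B₁ = row (suc (suc k)) (c ∘ suc) m
    A₂ = row (suc k) (c ∘ suc) (suc m)
    B₂ = row (suc (suc k)) (zc ∘ suc) m

  shift-< : ∀ {k i} x → i < k → shift k x i ≡ x i
  shift-< {k} {i} x i<k = ≡.cong (λ b → if b then x i else (if does (i ≟ k) then 0# else x (i ∸ 1))) (dec-true (i <? k) i<k)

  shift-≡ : ∀ k x → shift k x k ≡ 0#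
  shift-≡ k x = ≡.cong₂ (λ b b′ → if b then x k else (if b′ then 0# else x (k ∸ 1))) (dec-false (k <? k) (ℕₚ.n≮n k)) (dec-true (k ≟ k) ≡.refl)

  shift-> : ∀ {k i} x → k < i → shift k x i ≡ x (i ∸ 1)
  shift-> {k} {i} x k<i = ≡.cong₂ (λ b b′ → if b then x i else (if b′ then 0# else x (i ∸ 1))) (dec-false (i <? k) (ℕₚ.<⇒≯ k<i)) (dec-false (i ≟ k) (ℕₚ.>⇒≢ k<i))

  module Staircase (n : ℕ) (y : ℕ → Carrier) where

    rowOf : Carrier → ℕ → ℕ → Word
    rowOf a i m = row i (λ j → a ⊕ y j) m

    stairRow : (ℕ → Carrier) → ℕ → Word
    stairRow X i = rowOf (X i) i (n ∸ i)

    stairs : (ℕ → Carrier) → Word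
    stairs X = concatMap (stairRow X) (map suc (upTo n))

    stairs-local : ∀ {X X′} → (∀ i → i < n → X i ≡ X′ i) → stairs X ≡ stairs X′
    stairs-local {X} {X′} X≡X′ = concatMap-cong same-row (map suc (upTo n))
      where
      same-row : ∀ i → stairRow X i ≡ stairRow X′ i
      same-row i with i <? n
      ... | yes i<n = ≡.cong (λ a → rowOf a i (n ∸ i)) (X≡X′ i i<n)
      ... | no i≮n  = ≡.trans (≡.cong (rowOf (X i) i) empty) (≡.sym (≡.cong (rowOf (X′ i) i) empty))
        where empty = ℕₚ.m≤n⇒m∸n≡0 (ℕₚ.≮⇒≥ i≮n)

    stairs-agree : ∀ {X X′} L → (∀ {j} → j ∈ L → X j ≡ X′ j) → concatMap (stairRow X) L ≡ concatMap (stairRow X′) L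
    stairs-agree L X≡X′ = ≡.cong concat (map-cong-local (All.tabulate (λ {j} j∈L → ≡.cong (λ a → rowOf a j (n ∸ j)) (X≡X′ j∈L))))

    h-stairs-comm : ∀ {a} X L → (∀ {j} → j ∈ L → suc (suc a) ≤ j) → ∀ z F →
      h a z (⟦ concatMap (stairRow X) L ⟧ F) ≐ ⟦ concatMap (stairRow X) L ⟧ (h a z F)
    h-stairs-comm X []      _    z F = λ _ → refl
    h-stairs-comm {a} X (j ∷ L) a+2≤ z F = begin
      h a z (⟦ stairRow X j ++ concatMap (stairRow X) L ⟧ F)   ≡⟨ ≡.cong (h a z) (⟦⟧-++ (stairRow X j) _ F) ⟩
      h a z (⟦ stairRow X j ⟧ (⟦ concatMap (stairRow X) L ⟧ F)) ≈⟨ h-row-comm (a+2≤ (here ≡.refl)) z _ (n ∸ j) _ ⟩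
      ⟦ stairRow X j ⟧ (h a z (⟦ concatMap (stairRow X) L ⟧ F)) ≈⟨ ⟦⟧-cong (stairRow X j) (h-stairs-comm X L (a+2≤ ∘ there) z F) ⟩
      ⟦ stairRow X j ⟧ (⟦ concatMap (stairRow X) L ⟧ (h a z F)) ≡⟨ ⟦⟧-++ (stairRow X j) _ (h a z F) ⟨
      ⟦ stairRow X j ++ concatMap (stairRow X) L ⟧ (h a z F)   ∎
      where open ≐-Reasoning

    ⟦stairs⟧-split : ∀ X k t → n ≡ k +ℕ suc (suc t) → ∀ F →
      ⟦ stairs X ⟧ F ≡ ⟦ concatMap (stairRow X) (range 1 k) ⟧
                         (⟦ rowOf (X (suc k)) (suc k) (suc t) ⟧
                           (⟦ rowOf (X (2 +ℕ k)) (2 +ℕ k) t ⟧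
                             (⟦ concatMap (stairRow X) (range (3 +ℕ k) t) ⟧ F)))
    ⟦stairs⟧-split X k t n≡ F = begin
      ⟦ stairs X ⟧ F
        ≡⟨ ≡.cong (λ L → ⟦ concatMap (stairRow X) L ⟧ F) (≡.trans (map-suc-upTo n) (≡.trans (≡.cong (range 1) n≡) (range-+ 1 k (2 +ℕ t)))) ⟩
      ⟦ concatMap (stairRow X) (range 1 k ++ range (suc k) (2 +ℕ t)) ⟧ F
        ≡⟨ ≡.cong (λ W → ⟦ W ⟧ F) (concatMap-++ (stairRow X) (range 1 k) _) ⟩
      ⟦ Pre ++ (stairRow X (suc k) ++ (stairRow X (2 +ℕ k) ++ Post)) ⟧ F
        ≡⟨ ⟦⟧-++ Pre _ F ⟩
      ⟦ Pre ⟧ (⟦ stairRow X (suc k) ++ (stairRow X (2 +ℕ k) ++ Post) ⟧ F)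
        ≡⟨ ≡.cong ⟦ Pre ⟧ (≡.trans (⟦⟧-++ (stairRow X (suc k)) _ F) (≡.cong ⟦ stairRow X (suc k) ⟧ (⟦⟧-++ (stairRow X (2 +ℕ k)) Post F))) ⟩
      ⟦ Pre ⟧ (⟦ stairRow X (suc k) ⟧ (⟦ stairRow X (2 +ℕ k) ⟧ (⟦ Post ⟧ F)))
        ≡⟨ ≡.cong₂ (λ m m′ → ⟦ Pre ⟧ (⟦ rowOf (X (suc k)) (suc k) m ⟧ (⟦ rowOf (X (2 +ℕ k)) (2 +ℕ k) m′ ⟧ (⟦ Post ⟧ F)))) n∸1+k n∸2+k ⟩
      ⟦ Pre ⟧ (⟦ rowOf (X (suc k)) (suc k) (suc t) ⟧ (⟦ rowOf (X (2 +ℕ k)) (2 +ℕ k) t ⟧ (⟦ Post ⟧ F))) ∎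
      where
      open ≡.≡-Reasoning
      Pre = concatMap (stairRow X) (range 1 k)
      Post = concatMap (stairRow X) (range (3 +ℕ k) t)
      n∸1+k : n ∸ suc k ≡ suc t
      n∸1+k = ≡.trans (≡.cong (_∸ suc k) n≡) (≡.trans (≡.cong (_∸ suc k) (ℕₚ.+-suc k (suc t))) (ℕₚ.m+n∸m≡n k (suc t)))
      n∸2+k : n ∸ (2 +ℕ k) ≡ t
      n∸2+k = ≡.trans (≡.sym (ℕₚ.pred[m∸n]≡m∸[1+n] n (suc k))) (≡.cong ℕ.pred n∸1+k)

    rowOf-exchange : ∀ k t z G → ⟦ rowOf z k (suc t) ⟧ (⟦ rowOf 0# (suc k) t ⟧ G)
                                 ≐ ⟦ rowOf 0# k (suc t) ⟧ (⟦ rowOf z (suc k) t ⟧ (h k z G))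
    rowOf-exchange k t z G = begin
      ⟦ rowOf z k (suc t) ⟧ (⟦ rowOf 0# (suc k) t ⟧ G)
        ≈⟨ ⟦⟧-cong (rowOf z k (suc t)) (row-cong (suc k) t (λ j → ⊕-identityˡ (y j)) G) ⟩
      ⟦ rowOf z k (suc t) ⟧ (⟦ row (suc k) y t ⟧ G)
        ≈⟨ rows-exchange k t y z G ⟩
      ⟦ row k y (suc t) ⟧ (⟦ rowOf z (suc k) t ⟧ (h k z G))
        ≈⟨ row-cong k (suc t) (λ j → ⊕-identityˡ (y j)) _ ⟨
      ⟦ rowOf 0# k (suc t) ⟧ (⟦ rowOf z (suc k) t ⟧ (h k z G)) ∎
      where open ≐-Reasoning

    -- shift (2 + k) x and shift (suc k) x only differ in rows suc k and 2 + k, between which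
    -- the variable x (suc k) moves.
    ⟦stairs⟧-shift-step : ∀ x k t → n ≡ k +ℕ suc (suc t) → ∀ F →
      ⟦ stairs (shift (2 +ℕ k) x) ⟧ F ≐ ⟦ stairs (shift (suc k) x) ⟧ (h (suc k) (x (suc k)) F)
    ⟦stairs⟧-shift-step x k t n≡ F = begin
      ⟦ stairs X₁ ⟧ F
        ≡⟨ ⟦stairs⟧-split X₁ k t n≡ F ⟩
      ⟦ Pre X₁ ⟧ (⟦ rowOf (X₁ (suc k)) (suc k) (suc t) ⟧ (⟦ rowOf (X₁ (2 +ℕ k)) (2 +ℕ k) t ⟧ (⟦ Post X₁ ⟧ F)))
        ≡⟨ ≡.cong₂ (λ a b → ⟦ Pre X₁ ⟧ (⟦ rowOf a (suc k) (suc t) ⟧ (⟦ rowOf b (2 +ℕ k) t ⟧ (⟦ Post X₁ ⟧ F))))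
             (shift-< x (ℕₚ.n<1+n (suc k))) (shift-≡ (2 +ℕ k) x) ⟩
      ⟦ Pre X₁ ⟧ (⟦ rowOf z (suc k) (suc t) ⟧ (⟦ rowOf 0# (2 +ℕ k) t ⟧ (⟦ Post X₁ ⟧ F)))
        ≡⟨ ≡.cong₂ (λ P Q → ⟦ P ⟧ (⟦ rowOf z (suc k) (suc t) ⟧ (⟦ rowOf 0# (2 +ℕ k) t ⟧ (⟦ Q ⟧ F)))) pre post ⟩
      ⟦ Pre X₀ ⟧ (⟦ rowOf z (suc k) (suc t) ⟧ (⟦ rowOf 0# (2 +ℕ k) t ⟧ (⟦ Post X₀ ⟧ F)))
        ≈⟨ ⟦⟧-cong (Pre X₀) (rowOf-exchange (suc k) t z (⟦ Post X₀ ⟧ F)) ⟩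
      ⟦ Pre X₀ ⟧ (⟦ rowOf 0# (suc k) (suc t) ⟧ (⟦ rowOf z (2 +ℕ k) t ⟧ (h (suc k) z (⟦ Post X₀ ⟧ F))))
        ≈⟨ ⟦⟧-cong (Pre X₀) (⟦⟧-cong (rowOf 0# (suc k) (suc t)) (⟦⟧-cong (rowOf z (2 +ℕ k) t)
             (h-stairs-comm X₀ (range (3 +ℕ k) t) (proj₁ ∘ ∈-range) z F))) ⟩
      ⟦ Pre X₀ ⟧ (⟦ rowOf 0# (suc k) (suc t) ⟧ (⟦ rowOf z (2 +ℕ k) t ⟧ (⟦ Post X₀ ⟧ (h (suc k) z F))))
        ≡⟨ ≡.cong₂ (λ a b → ⟦ Pre X₀ ⟧ (⟦ rowOf a (suc k) (suc t) ⟧ (⟦ rowOf b (2 +ℕ k) t ⟧ (⟦ Post X₀ ⟧ (h (suc k) z F)))))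
             (shift-≡ (suc k) x) (shift-> x ≤-refl) ⟨
      ⟦ Pre X₀ ⟧ (⟦ rowOf (X₀ (suc k)) (suc k) (suc t) ⟧ (⟦ rowOf (X₀ (2 +ℕ k)) (2 +ℕ k) t ⟧ (⟦ Post X₀ ⟧ (h (suc k) z F))))
        ≡⟨ ⟦stairs⟧-split X₀ k t n≡ (h (suc k) z F) ⟨
      ⟦ stairs X₀ ⟧ (h (suc k) z F) ∎
      where
      open ≐-Reasoning
      X₁ = shift (2 +ℕ k) x
      X₀ = shift (suc k) x
      z = x (suc k)
      Pre Post : (ℕ → Carrier) → Word
      Pre X = concatMap (stairRow X) (range 1 k)
      Post X = concatMap (stairRow X) (range (3 +ℕ k) t)
      pre : Pre X₁ ≡ Pre X₀
      pre = stairs-agree (range 1 k) λ j∈ → let j<1+k = proj₂ (∈-range j∈) in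
        ≡.trans (shift-< x (ℕₚ.m<n⇒m<1+n j<1+k)) (≡.sym (shift-< x j<1+k))
      post : Post X₁ ≡ Post X₀
      post = stairs-agree (range (3 +ℕ k) t) λ j∈ → let 2+k<j = proj₁ (∈-range j∈) in
        ≡.trans (shift-> x 2+k<j) (≡.sym (shift-> x (ℕₚ.<-trans (ℕₚ.n<1+n (suc k)) 2+k<j)))

    ⟦stairs⟧-telescope-from : ∀ x F m → m ≤ n ∸ 1 → ⟦ stairs (shift (suc m) x) ⟧ F ≐ λ v →
      ⟦ stairs (shift 1 x) ⟧ F v + sumL (range 1 m) (λ k → x k * ⟦ stairs (shift k x) ⟧ (π k F) v)
    ⟦stairs⟧-telescope-from x F zero    _     v = sym (+-identityʳ _)
    ⟦stairs⟧-telescope-from x F (suc m) m<n∸1 v = begin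
      ⟦ stairs (shift (2 +ℕ m) x) ⟧ F v
        ≈⟨ ⟦stairs⟧-shift-step x m _ (≤∸1-split m<n∸1) F v ⟩
      ⟦ stairs (shift (suc m) x) ⟧ (h (suc m) (x (suc m)) F) v
        ≈⟨ h-expand (⟦⟧-linear (stairs (shift (suc m) x))) (suc m) (x (suc m)) F v ⟩
      ⟦ stairs (shift (suc m) x) ⟧ F v + term (suc m)
        ≈⟨ +-congʳ (⟦stairs⟧-telescope-from x F m (≤-trans (ℕₚ.n≤1+n m) m<n∸1) v) ⟩
      (⟦ stairs (shift 1 x) ⟧ F v + sumL (range 1 m) term) + term (suc m)
        ≈⟨ +-assoc _ _ _ ⟩
      ⟦ stairs (shift 1 x) ⟧ F v + (sumL (range 1 m) term + term (suc m))
        ≈⟨ +-congˡ (sumL-range-snoc m term) ⟨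
      ⟦ stairs (shift 1 x) ⟧ F v + sumL (range 1 (suc m)) term ∎
      where
      open ≈-Reasoning
      term : ℕ → Carrier
      term k = x k * ⟦ stairs (shift k x) ⟧ (π k F) v

    ⟦stairs⟧-telescope : ∀ x F → ⟦ stairs x ⟧ F ≐ λ v →
      ⟦ stairs (shift 1 x) ⟧ F v + sumL (map suc (upTo (n ∸ 1))) (λ k → x k * ⟦ stairs (shift k x) ⟧ (π k F) v)
    ⟦stairs⟧-telescope x F v = begin
      ⟦ stairs x ⟧ F v
        ≡⟨ ≡.cong (λ W → ⟦ W ⟧ F v) (stairs-local (λ i i<n → ≡.sym (shift-< x (<⇒<suc[∸1] i<n)))) ⟩
      ⟦ stairs (shift (suc (n ∸ 1)) x) ⟧ F v
        ≈⟨ ⟦stairs⟧-telescope-from x F (n ∸ 1) ≤-refl v ⟩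
      ⟦ stairs (shift 1 x) ⟧ F v + sumL (range 1 (n ∸ 1)) term
        ≡⟨ ≡.cong (λ L → ⟦ stairs (shift 1 x) ⟧ F v + sumL L term) (map-suc-upTo (n ∸ 1)) ⟨
      ⟦ stairs (shift 1 x) ⟧ F v + sumL (map suc (upTo (n ∸ 1))) term ∎
      where
      open ≈-Reasoning
      term : ℕ → Carrier
      term k = x k * ⟦ stairs (shift k x) ⟧ (π k F) v

  -- Super pipe dreams as a transfer matrix

  δ : List ℕ → Fun
  δ w u = if u == w then 1# else 0#

  module PipeDreams (X y : ℕ → Carrier) where

    cellLetter : ℕ × ℕ → ℕ × Carrier
    cellLetter (i , j) = ((i +ℕ j) ∸ 1 , X i ⊕ y j)

    pathStep : List ℕ → (ℕ × ℕ) × Bool → List ℕ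
    pathStep w ((i , j) , true)  = dem w ((i +ℕ j) ∸ 1)
    pathStep w (_       , false) = w

    path : List ℕ → List (ℕ × ℕ) → List Bool → List ℕ
    path v cs m = foldl pathStep v (zip cs m)

    len-path-≤ : ∀ v cs m → len (path v cs m) ≤ card m +ℕ len v
    len-path-≤ v []            m           = ℕₚ.m≤n+m (len v) (card m)
    len-path-≤ v (c ∷ cs)      []          = ≤-refl
    len-path-≤ v ((i , j) ∷ cs) (true ∷ m)  = ≤-trans (len-path-≤ (dem v ((i +ℕ j) ∸ 1)) cs m)
      (≤-trans (ℕₚ.+-monoʳ-≤ (card m) (len-dem-≤ v _)) (≤-reflexive (ℕₚ.+-suc (card m) (len v))))
    len-path-≤ v (c ∷ cs)      (false ∷ m) = len-path-≤ v cs m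

    dreamTerm : List ℕ → List (ℕ × ℕ) → Fun → List Bool → List Bool → Carrier
    dreamTerm v cs g px py =
      g (path v cs (zipWith _∨_ px py))
      * (pow β ((card px +ℕ card py +ℕ len v) ∸ len (path v cs (zipWith _∨_ px py)))
         * (prodCells (zip cs px) (X ∘ proj₁) * prodCells (zip cs py) (y ∘ proj₂)))

    -- Generalises G n w = dreamSum (idPerm n) (cells n) (δ w) to any starting permutation v and
    -- any weight g of the final permutation.
    dreamSum : List ℕ → List (ℕ × ℕ) → Fun → Carrier
    dreamSum v cs g = sum² (masks (length cs)) (dreamTerm v cs g)

    cellFactor : ∀ {C} d e E′ g′ xm ym PX PY {PXc PYc} → C ≡ d +ℕ e +ℕ E′ → PXc ≈ xm * PX → PYc ≈ ym * PY →
      g′ * (pow β C * (PXc * PYc)) ≈ (pow β d * (xm * ym) * pow β e) * (g′ * (pow β E′ * (PX * PY)))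
    cellFactor d e E′ g′ xm ym PX PY ≡.refl PXc≈ PYc≈ = begin
      g′ * (pow β (d +ℕ e +ℕ E′) * (_ * _))
        ≈⟨ *-congˡ (*-cong (trans (pow-+ (d +ℕ e) E′) (*-congʳ (pow-+ d e))) (*-cong PXc≈ PYc≈)) ⟩
      g′ * ((pow β d * pow β e * pow β E′) * ((xm * PX) * (ym * PY)))
        ≈⟨ solve 8 (λ g′ bd be bE xm ym PX PY → g′ :* ((bd :* be :* bE) :* ((xm :* PX) :* (ym :* PY)))
                      := (bd :* (xm :* ym) :* be) :* (g′ :* (bE :* (PX :* PY))))
                   refl g′ (pow β d) (pow β e) (pow β E′) xm ym PX PY ⟩
      (pow β d * (xm * ym) * pow β e) * (g′ * (pow β E′ * (PX * PY))) ∎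
      where open ≈-Reasoning

    dreamSum-cons : ∀ i j cs v g → dreamSum v ((i , j) ∷ cs) g ≈
      dreamSum v cs g + (X i ⊕ y j) * π ((i +ℕ j) ∸ 1) (λ u → dreamSum u cs g) v
    dreamSum-cons i j cs v g = begin
      dreamSum v ((i , j) ∷ cs) g
        ≈⟨ sum²-masks (length cs) (dreamTerm v ((i , j) ∷ cs) g) ⟩
      (S true true + S true false) + (S false true + dreamSum v cs g)
        ≈⟨ +-cong (+-cong (sum²-* M _ (λ px py → selected px py 1 (≡.cong suc (ℕₚ.+-suc (card px) (card py))) refl refl))
                          (sum²-* M _ (λ px py → selected px py 0 ≡.refl refl (sym (*-identityˡ _)))))
                  (+-congʳ (sum²-* M _ (λ px py → selected px py 0 (ℕₚ.+-suc (card px) (card py)) (sym (*-identityˡ _)) refl))) ⟩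
      ((β * 1# * (X i * y j) * pe) * D′ + (1# * (X i * 1#) * pe) * D′) + ((1# * (1# * y j) * pe) * D′ + dreamSum v cs g)
        ≈⟨ solve 6 (λ xi yj b pe D′ D →
                      ((b :* con 1 :* (xi :* yj) :* pe) :* D′ :+ (con 1 :* (xi :* con 1) :* pe) :* D′)
                        :+ ((con 1 :* (con 1 :* yj) :* pe) :* D′ :+ D)
                      := D :+ (xi :+ yj :+ b :* (xi :* yj)) :* (pe :* D′))
                   refl (X i) (y j) β pe D′ (dreamSum v cs g) ⟩
      dreamSum v cs g + (X i ⊕ y j) * (pe * D′) ∎
      where
      open ≈-Reasoning
      M = masks (length cs)
      a = (i +ℕ j) ∸ 1
      v′ = dem v a
      pe = pow β (suc (len v) ∸ len v′)
      D′ = dreamSum v′ cs g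
      S : Bool → Bool → Carrier
      S bx by = sum² M (λ px py → dreamTerm v ((i , j) ∷ cs) g (bx ∷ px) (by ∷ py))
      selected : ∀ px py d {C xm ym PXc PYc} → C ≡ d +ℕ suc (card px +ℕ card py) →
        PXc ≈ xm * prodCells (zip cs px) (X ∘ proj₁) → PYc ≈ ym * prodCells (zip cs py) (y ∘ proj₂) →
        g (path v′ cs (zipWith _∨_ px py)) * (pow β ((C +ℕ len v) ∸ len (path v′ cs (zipWith _∨_ px py))) * (PXc * PYc))
          ≈ (pow β d * (xm * ym) * pe) * dreamTerm v′ cs g px py
      selected px py d C≡ PXc≈ PYc≈ =
        cellFactor d _ _ _ _ _ _ _ (∸-split d C≡ (len-dem-≤ v a) bound) PXc≈ PYc≈
        where
        bound : len (path v′ cs (zipWith _∨_ px py)) ≤ card px +ℕ card py +ℕ len v′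
        bound = ≤-trans (len-path-≤ v′ cs _) (ℕₚ.+-monoˡ-≤ (len v′) (card-∨ px py))

    dreamSum-word : ∀ cs g → (λ v → dreamSum v cs g) ≐ ⟦ map cellLetter cs ⟧ g
    dreamSum-word []             g v = begin
      (g v * (pow β (len v ∸ len v) * (1# * 1#)) + 0#) + 0#
        ≈⟨ trans (+-identityʳ _) (+-identityʳ _) ⟩
      g v * (pow β (len v ∸ len v) * (1# * 1#))
        ≡⟨ ≡.cong (λ k → g v * (pow β k * (1# * 1#))) (n∸n≡0 (len v)) ⟩
      g v * (1# * (1# * 1#))
        ≈⟨ trans (*-congˡ (trans (*-identityˡ _) (*-identityˡ _))) (*-identityʳ _) ⟩
      g v ∎
      where open ≈-Reasoning
    dreamSum-word ((i , j) ∷ cs) g v =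
      trans (dreamSum-cons i j cs v g) (h-cong ((i +ℕ j) ∸ 1) refl (dreamSum-word cs g) v)

    cells-word : ∀ n → map cellLetter (cells n) ≡ Staircase.stairs n y X
    cells-word n = ≡.trans (map-concatMap cellLetter _ (map suc (upTo n))) (concatMap-cong (λ i → row-word i (n ∸ i)) (map suc (upTo n)))
      where
      row-word : ∀ i m → map cellLetter (map (λ j → (i , j)) (map suc (downFrom m))) ≡ Staircase.rowOf n y (X i) i m
      row-word i zero    = ≡.refl
      row-word i (suc m) = ≡.cong₂ _∷_ (≡.cong (λ l → (l ∸ 1 , X i ⊕ y (suc m))) (ℕₚ.+-suc i m)) (row-word i m)

    ∂≡path : ∀ n m → ∂ n m ≡ path (idPerm n) (cells n) m
    ∂≡path n m = foldl-cong (λ { w ((i , j) , true) → ≡.refl ; w (_ , false) → ≡.refl }) (idPerm n) (zip (cells n) m)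

  G≈⟦stairs⟧ : ∀ n X y w → G n w β X y ≈ ⟦ Staircase.stairs n y X ⟧ (δ w) (idPerm n)
  G≈⟦stairs⟧ n X y w = begin
    G n w β X y                                   ≈⟨ sumL-cong M (λ px → sumL-cong M (summand px)) ⟩
    dreamSum (idPerm n) (cells n) (δ w)           ≈⟨ dreamSum-word (cells n) (δ w) (idPerm n) ⟩
    ⟦ map cellLetter (cells n) ⟧ (δ w) (idPerm n) ≡⟨ ≡.cong (λ W → ⟦ W ⟧ (δ w) (idPerm n)) (cells-word n) ⟩
    ⟦ Staircase.stairs n y X ⟧ (δ w) (idPerm n)   ∎
    where
    open ≈-Reasoning
    open PipeDreams X y
    M = masks (length (cells n))
    summand : ∀ px py → (if ∂ n (zipWith _∨_ px py) == w then weight n px py β X y else 0#)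
                        ≈ dreamTerm (idPerm n) (cells n) (δ w) px py
    summand px py rewrite ∂≡path n (zipWith _∨_ px py) | len-idPerm n | ℕₚ.+-identityʳ (card px +ℕ card py)
      with path (idPerm n) (cells n) (zipWith _∨_ px py) == w
    ... | true  = sym (*-identityˡ _)
    ... | false = sym (zeroˡ _)

  δ-∷ : ∀ b u r → δ (b ∷ u) (b ∷ r) ≡ δ u r
  δ-∷ b u r = ≡.cong (λ t → if t ∧ (r == u) then 1# else 0#) (dec-true (b ≟ b) ≡.refl)

  δ-∷-≢ : ∀ {b b′} u r → b′ ≢ b → δ (b ∷ u) (b′ ∷ r) ≡ 0#
  δ-∷-≢ {b} {b′} u r b′≢b = ≡.cong (λ t → if t ∧ (r == u) then 1# else 0#) (dec-false (b′ ≟ b) b′≢b)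

  δ-≢ : ∀ {u v} → v ≢ u → δ u v ≡ 0#
  δ-≢ {u} {v} v≢u = ≡.cong (λ t → if t then 1# else 0#) (dec-false (≡-dec _≟_ v u) v≢u)

  sumL-δ-∉ : ∀ L {v} → v ∉ L → sumL L (λ u → δ u v) ≈ 0#
  sumL-δ-∉ []      v∉L = refl
  sumL-δ-∉ (u ∷ L) v∉L = trans (+-cong (reflexive (δ-≢ (v∉L ∘ here))) (sumL-δ-∉ L (v∉L ∘ there))) (+-identityʳ 0#)

  ∈-insertAll : ∀ {a u} l → u ∈ insertAll a l → a ∈ u
  ∈-insertAll []       (here ≡.refl) = here ≡.refl
  ∈-insertAll (b ∷ bs) (here ≡.refl) = here ≡.refl
  ∈-insertAll (b ∷ bs) (there u∈)    with ∈-map⁻ (b ∷_) u∈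
  ... | u′ , u′∈ , ≡.refl = there (∈-insertAll bs u′∈)

  sumL-insertAll-δ : ∀ a l xs ys → a ∉ xs → a ∉ ys →
    sumL (insertAll a l) (λ u → δ u (xs ++ a ∷ ys)) ≈ δ l (xs ++ ys)
  sumL-insertAll-δ a [] [] ys a∉xs a∉ys = trans (+-identityʳ _) (reflexive (δ-∷ a [] ys))
  sumL-insertAll-δ a [] (x ∷ xs) ys a∉xs a∉ys =
    trans (+-identityʳ _) (reflexive (δ-∷-≢ [] (xs ++ a ∷ ys) (λ x≡a → a∉xs (here (≡.sym x≡a)))))
  sumL-insertAll-δ a (b ∷ bs) [] ys a∉xs a∉ys = begin
    δ (a ∷ b ∷ bs) (a ∷ ys) + sumL (map (b ∷_) (insertAll a bs)) (λ u → δ u (a ∷ ys))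
      ≡⟨ ≡.cong₂ _+_ (δ-∷ a (b ∷ bs) ys) (sumL-map (b ∷_) (insertAll a bs) _) ⟩
    δ (b ∷ bs) ys + sumL (insertAll a bs) (λ u → δ (b ∷ u) (a ∷ ys))
      ≈⟨ +-congˡ rest ⟩
    δ (b ∷ bs) ys + 0#
      ≈⟨ +-identityʳ _ ⟩
    δ (b ∷ bs) ys ∎
    where
    open ≈-Reasoning
    rest : sumL (insertAll a bs) (λ u → δ (b ∷ u) (a ∷ ys)) ≈ 0#
    rest with a ≟ b
    ... | yes ≡.refl = trans (sumL-cong (insertAll a bs) (λ u → reflexive (δ-∷ a u ys)))
                             (sumL-δ-∉ (insertAll a bs) (a∉ys ∘ ∈-insertAll bs))
    ... | no a≢b     = sumL-zero (insertAll a bs) (λ u → δ-∷-≢ u ys a≢b)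
  sumL-insertAll-δ a (b ∷ bs) (x ∷ xs) ys a∉xs a∉ys = begin
    δ (a ∷ b ∷ bs) (x ∷ xs ++ a ∷ ys) + sumL (map (b ∷_) (insertAll a bs)) (λ u → δ u (x ∷ xs ++ a ∷ ys))
      ≡⟨ ≡.cong₂ _+_ (δ-∷-≢ (b ∷ bs) (xs ++ a ∷ ys) (λ x≡a → a∉xs (here (≡.sym x≡a)))) (sumL-map (b ∷_) (insertAll a bs) _) ⟩
    0# + sumL (insertAll a bs) (λ u → δ (b ∷ u) (x ∷ xs ++ a ∷ ys))
      ≈⟨ +-identityˡ _ ⟩
    sumL (insertAll a bs) (λ u → δ (b ∷ u) (x ∷ xs ++ a ∷ ys))
      ≈⟨ rest ⟩
    δ (b ∷ bs) (x ∷ xs ++ ys) ∎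
    where
    open ≈-Reasoning
    rest : sumL (insertAll a bs) (λ u → δ (b ∷ u) (x ∷ xs ++ a ∷ ys)) ≈ δ (b ∷ bs) (x ∷ xs ++ ys)
    rest with x ≟ b
    ... | yes ≡.refl = trans (sumL-cong (insertAll a bs) (λ u → reflexive (δ-∷ x u (xs ++ a ∷ ys))))
                             (trans (sumL-insertAll-δ a bs xs ys (a∉xs ∘ there) a∉ys) (reflexive (≡.sym (δ-∷ x bs (xs ++ ys)))))
    ... | no x≢b     = trans (sumL-zero (insertAll a bs) (λ u → δ-∷-≢ u (xs ++ a ∷ ys) x≢b)) (reflexive (≡.sym (δ-∷-≢ bs (xs ++ ys) x≢b)))

  sumL-Sym-δ : ∀ n v → v ↭ idPerm n → sumL (Sym n) (λ u → δ u v) ≈ 1#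
  sumL-Sym-δ zero v v↭[] with ↭-empty-inv v↭[]
  ... | ≡.refl = +-identityʳ 1#
  sumL-Sym-δ (suc m) v v↭ with ∈-∃++ (∈-resp-↭ (↭-sym v↭′) (∈-++⁺ʳ (idPerm m) (here ≡.refl)))
    where
    v↭′ : v ↭ idPerm m ++ [ suc m ] ++ []
    v↭′ = ≡.subst (v ↭_) (idPerm-suc m) v↭
  ... | xs , ys , ≡.refl = begin
    sumL (concatMap (insertAll (suc m)) (Sym m)) (λ u → δ u (xs ++ suc m ∷ ys))
      ≈⟨ sumL-concatMap (insertAll (suc m)) (Sym m) _ ⟩
    sumL (Sym m) (λ l → sumL (insertAll (suc m) l) (λ u → δ u (xs ++ suc m ∷ ys)))
      ≈⟨ sumL-cong (Sym m) (λ l → sumL-insertAll-δ (suc m) l xs ys (new∉ ∘ ∈-++⁺ˡ) (new∉ ∘ ∈-++⁺ʳ xs)) ⟩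
    sumL (Sym m) (λ l → δ l (xs ++ ys))
      ≈⟨ sumL-Sym-δ m (xs ++ ys) rest↭ ⟩
    1# ∎
    where
    open ≈-Reasoning
    rest↭ : xs ++ ys ↭ idPerm m
    rest↭ = ≡.subst (xs ++ ys ↭_) (++-identityʳ (idPerm m))
      (drop-mid xs (idPerm m) (≡.subst (xs ++ [ suc m ] ++ ys ↭_) (idPerm-suc m) v↭))
    new∉ : suc m ∉ xs ++ ys
    new∉ sm∈ = ℕₚ.<-irrefl ≡.refl (proj₂ (∈-range (≡.subst (suc m ∈_) (map-suc-upTo m) (∈-resp-↭ rest↭ sm∈))))

  sumL-Sym-expand : ∀ n v → v ↭ idPerm n → ∀ (φ : Fun) → sumL (Sym n) (λ u → φ u * δ u v) ≈ φ v
  sumL-Sym-expand n v v↭ φ = begin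
    sumL (Sym n) (λ u → φ u * δ u v) ≈⟨ sumL-cong (Sym n) concentrate ⟩
    sumL (Sym n) (λ u → φ v * δ u v) ≈⟨ sumL-* (Sym n) (φ v) (λ u → δ u v) ⟩
    φ v * sumL (Sym n) (λ u → δ u v) ≈⟨ *-congˡ (sumL-Sym-δ n v v↭) ⟩
    φ v * 1#                         ≈⟨ *-identityʳ (φ v) ⟩
    φ v                              ∎
    where
    open ≈-Reasoning
    concentrate : ∀ u → φ u * δ u v ≈ φ v * δ u v
    concentrate u with ≡-dec _≟_ v u
    ... | yes ≡.refl = refl
    ... | no _       = trans (zeroʳ (φ u)) (sym (zeroʳ (φ v)))

  module Coefficients (n : ℕ) (x y : ℕ → Carrier) where
    open Staircase n y using (stairs)

    coefficient : ℕ → List ℕ → List ℕ → Carrier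
    coefficient k w u = if dem u k == w then (if w == u then β else 1#) * x k else 0#

    coefficient≈xπ : ∀ k w v → coefficient k w v ≈ x k * π k (δ w) v
    coefficient≈xπ k w v with dem-cases v k
    ... | inj₁ stay rewrite stay | ℕₚ.m+n∸n≡m 1 (len v) with ≡-dec _≟_ v w
    ...   | yes ≡.refl rewrite dec-true (≡-dec _≟_ v v) ≡.refl =
            solve 2 (λ b xk → b :* xk := xk :* ((b :* con 1) :* con 1)) refl β (x k)
    ...   | no _ = sym (trans (*-congˡ (zeroʳ _)) (zeroʳ _))
    coefficient≈xπ k w v | inj₂ up with ≡-dec _≟_ (dem v k) w
    ...   | yes ≡.refl rewrite dec-false (≡-dec _≟_ (dem v k) v) (λ e → ℕₚ.1+n≢n (≡.trans (≡.sym up) (≡.cong len e)))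
                             | up | n∸n≡0 (len v) = trans (*-identityˡ _) (sym (trans (*-congˡ (*-identityˡ 1#)) (*-identityʳ _)))
    ...   | no _ = sym (trans (*-congˡ (zeroʳ _)) (zeroʳ _))

    sumL-Sym-coefficient : ∀ k w →
      sumL (Sym n) (λ u → if dem u k == w then ((if w == u then β else 1#) * x k) * G n u β (shift k x) y else 0#)
        ≈ x k * ⟦ stairs (shift k x) ⟧ (π k (δ w)) (idPerm n)
    sumL-Sym-coefficient k w = begin
      sumL (Sym n) (λ u → if dem u k == w then ((if w == u then β else 1#) * x k) * G n u β (shift k x) y else 0#)
        ≈⟨ sumL-cong (Sym n) factor ⟩
      sumL (Sym n) (λ u → coefficient k w u * ⟦ W ⟧ (δ u) (idPerm n))
        ≈⟨ sumL-cong (Sym n) (λ u → *-hom (⟦⟧-linear W) (coefficient k w u) (δ u) (idPerm n)) ⟨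
      sumL (Sym n) (λ u → ⟦ W ⟧ (λ v → coefficient k w u * δ u v) (idPerm n))
        ≈⟨ linear-sumL (⟦⟧-linear W) (Sym n) (λ u v → coefficient k w u * δ u v) (idPerm n) ⟨
      ⟦ W ⟧ (λ v → sumL (Sym n) (λ u → coefficient k w u * δ u v)) (idPerm n)
        ≈⟨ ⟦⟧-local W (idPerm n) (λ v v↭ → sumL-Sym-expand n v v↭ (coefficient k w)) ⟩
      ⟦ W ⟧ (coefficient k w) (idPerm n)
        ≈⟨ ⟦⟧-cong W (coefficient≈xπ k w) (idPerm n) ⟩
      ⟦ W ⟧ (λ v → x k * π k (δ w) v) (idPerm n)
        ≈⟨ *-hom (⟦⟧-linear W) (x k) (π k (δ w)) (idPerm n) ⟩
      x k * ⟦ W ⟧ (π k (δ w)) (idPerm n) ∎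
      where
      open ≈-Reasoning
      W = stairs (shift k x)
      factor : ∀ u → (if dem u k == w then ((if w == u then β else 1#) * x k) * G n u β (shift k x) y else 0#)
                     ≈ coefficient k w u * ⟦ W ⟧ (δ u) (idPerm n)
      factor u with dem u k == w
      ... | true  = *-congˡ (G≈⟦stairs⟧ n (shift k x) y u)
      ... | false = sym (zeroˡ _)

proposition7p10 : {c ℓ : Level} (R : CommutativeRing c ℓ) (n : ℕ) (w : List ℕ) → w ∈ Sym n →
    (β : CommutativeRing.Carrier R) (x y : ℕ → CommutativeRing.Carrier R) →
    CommutativeRing._≈_ R
      (Poly.G R n w β x y)
      (CommutativeRing._+_ R
        (Poly.Rop R 1 (Poly.G R n w) β x y)
        (Poly.sumL R (cartesianProduct (Sym n) (map suc (upTo (n ∸ 1)))) λ uk →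
          if dem (proj₁ uk) (proj₂ uk) == w
          then CommutativeRing._*_ R
                 (CommutativeRing._*_ R
                   (if w == proj₁ uk then β else CommutativeRing.1# R)
                   (x (proj₂ uk)))
                 (Poly.Rop R (proj₂ uk) (Poly.G R n (proj₁ uk)) β x y)
          else CommutativeRing.0# R))
proposition7p10 R n w _ β x y = begin
  G n w β x y
    ≈⟨ G≈⟦stairs⟧ n x y w ⟩
  ⟦ stairs x ⟧ (δ w) (idPerm n)
    ≈⟨ ⟦stairs⟧-telescope x (δ w) (idPerm n) ⟩
  ⟦ stairs (shift 1 x) ⟧ (δ w) (idPerm n) + sumL Ks (λ k → x k * ⟦ stairs (shift k x) ⟧ (π k (δ w)) (idPerm n))
    ≈⟨ +-cong (sym (G≈⟦stairs⟧ n (shift 1 x) y w)) (sumL-cong Ks (λ k → sym (sumL-Sym-coefficient k w))) ⟩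
  G n w β (shift 1 x) y + sumL Ks (λ k → sumL (Sym n) (λ u → f (u , k)))
    ≈⟨ +-congˡ (trans (sumL-cartesianProduct (Sym n) Ks f) (sumL-swap (Sym n) Ks (λ u k → f (u , k)))) ⟨
  G n w β (shift 1 x) y + sumL (cartesianProduct (Sym n) Ks) f ∎
  where
  open CommutativeRing R
  open Poly R using (G; sumL; shift)
  open DemazureOperators R β
  open Staircase n y
  open Coefficients n x y
  open ≈-Reasoning
  Ks = map suc (upTo (n ∸ 1))
  f : List ℕ × ℕ → Carrier
  f (u , k) = if dem u k == w then ((if w == u then β else 1#) * x k) * G n u β (shift k x) y else 0#
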